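{- Let $h\ge0$ and $k\ge1$ be integers with $h+k\ge2$, and let $H$ be an internally Eulerian subgraph of $G_{h,k}$ consisting of a single loop (and no leaf-paths). For every nonnegative even integer $t$, $$\mathrm{vol}_t(G_{h,k},\emptyset)-\mathrm{vol}_t(G_{h,k},H)=\begin{cases}(\frac t2+1)^{k-1} & \text{if } t\equiv0\pmod 4 \text{ or } h=0,\\ 0 & \text{if } t\equiv 2\pmod 4 \text{ and } h\ge1.\end{cases}$$
   Context: A $\{1,3\}$-graph is a finite graph (loops and parallel edges allowed, a loop contributing $2$ to the degree) in which every node has degree $1$ (leaf) or $3$ (internal node); $E$ is the edge set, $I$ the internal node set. For each internal node $v$ with incident edges $a,b,c$ listed with multiplicity (a loop listed twice), $\mathcal{Q}_G\subset\mathbb{R}^E\times\mathbb{R}^I$ is defined by $w_a\le w_b+w_c$, $w_b\le w_a+w_c$, $w_c\le w_a+w_b$, $w_a+w_b+w_c=2z_v$, $z_v\le1$. A caterpillar is a tree whose removal of all leaves leaves a path (the central path) or the empty graph; legs are edges off the central path. For $h+k\ge2$, $G_{h,k}$ is obtained from a $\{1,3\}$-tree caterpillar with $h+k$ leaves by attaching a loop at $k$ of its leaves, so that in the order of the legs along the central path the legs with loops are consecutive and those without are consecutive. A subgraph $H$ is internally Eulerian if every internal node has degree $0$ or $2$ in $H$. For an integer $t\ge0$, $\mathrm{vol}_t(G,H)$ is the number of $(w,z)\in t\mathcal{Q}_G\cap(\mathbb{Z}^E\times\mathbb{Z}^I)$ with $w-\mathbbm{1}_H\in2\mathbb{Z}^E$,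 where $\mathbbm{1}_H$ is the characteristic vector of the edge set of $H$ ($\mathbbm{1}_\emptyset=0$). -}

module Defs where

open import Data.Nat as ℕ using (ℕ; zero; suc; _<?_)
open import Data.Integer as ℤ using (ℤ; +_; _+_; _-_; _*_; _≤_)
open import Data.Integer.Divisibility using (_∣_)
open import Data.Fin using (Fin; zero; suc; _↑ˡ_; _↑ʳ_; inject₁; fromℕ; fromℕ<; splitAt; toℕ)
open import Data.Fin.Subset using (Subset)
open import Data.Vec using (Vec; lookup)
open import Data.Bool using (Bool; true; false; if_then_else_)
open import Data.Product using (Σ; ∃; _×_; _,_)
open import Data.Sum using (_⊎_; inj₁; inj₂)
open import Data.List using (List)
import Data.List.Membership.Propositional as LMem
open import Data.List.Relation.Unary.Unique.Propositional using (Unique)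
open import Relation.Binary.PropositionalEquality using (_≡_)
open import Relation.Nullary using (yes; no)

-- Q_G and "internally Eulerian" only depend on the edge set and, for
-- each internal node v, the list (a , b , c) of edges incident to v
-- listed with multiplicity (a loop at v is listed twice).  Leaves carry
-- no data.

record Graph13 : Set where
  field
    nE  : ℕ
    nI  : ℕ
    inc : Fin nI → Fin nE × Fin nE × Fin nE
open Graph13 public

IsLoop : (G : Graph13) → Fin (nE G) → Set
IsLoop G e = Σ (Fin (nI G)) λ v → Occ2 (inc G v)
  where
  Occ2 : Fin (nE G) × Fin (nE G) × Fin (nE G) → Set
  Occ2 (a , b , c) = (a ≡ e × b ≡ e) ⊎ (a ≡ e × c ≡ e) ⊎ (b ≡ e × c ≡ e)

-- subgraphs are given by their edge sets
𝟙 : {n : ℕ} → Subset n → Fin n → ℤ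
𝟙 H e = if lookup H e then + 1 else + 0

degIn : (G : Graph13) → Subset (nE G) → Fin (nI G) → ℕ
degIn G H v with inc G v
... | (a , b , c) = b2n (lookup H a) ℕ.+ b2n (lookup H b) ℕ.+ b2n (lookup H c)
  where
  b2n : Bool → ℕ
  b2n true = 1
  b2n false = 0

InternallyEulerian : (G : Graph13) → Subset (nE G) → Set
InternallyEulerian G H = ∀ v → degIn G H v ≡ 0 ⊎ degIn G H v ≡ 2

InTQ : ℕ → (G : Graph13) → Vec ℤ (nE G) → Vec ℤ (nI G) → Set
InTQ t G w z = ∀ v → Node (inc G v) (lookup z v)
  where
  Node : Fin (nE G) × Fin (nE G) × Fin (nE G) → ℤ → Set
  Node (a , b , c) zv =
    let wa = lookup w a ; wb = lookup w b ; wc = lookup w c in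
    (wa ≤ wb + wc) × (wb ≤ wa + wc) × (wc ≤ wa + wb)
    × (wa + wb + wc ≡ + 2 * zv) × (zv ≤ + t)

VolPoint : ℕ → (G : Graph13) → Subset (nE G) → Vec ℤ (nE G) × Vec ℤ (nI G) → Set
VolPoint t G H (w , z) = InTQ t G w z × (∀ e → + 2 ∣ (lookup w e - 𝟙 H e))

record Enumerates {A : Set} (P : A → Set) (xs : List A) : Set where
  open LMem
  field
    unique   : Unique xs
    sound    : ∀ x → x ∈ xs → P x
    complete : ∀ x → P x → x ∈ xs

VolIs : ℕ → (G : Graph13) → Subset (nE G) → ℕ → Set
VolIs t G H N = Σ (List _) λ xs → Enumerates (VolPoint t G H) xs × Data.List.length xs ≡ N
  where import Data.List

-- Put n = h + k = m + 2 (leaves of the caterpillar).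
-- Edges (nE = (m+1) + m + k):
--   P j  (j < m+1) : edges of the path  leaf₀ - C₀ - C₁ - ... - C_{m-1} - leaf_{n-1}
--                    (P 0 and P m are the two end legs; P 1..P (m-1) the spine)
--   M j  (j < m)   : the leg hanging off the central-path node C j
--   L i  (i < k)   : the loop attached at the i-th leg
-- Legs, in their order along the central path:
--   leg 0 = P 0, leg (j+1) = M j (j < m), leg (m+1) = P m.
-- Internal nodes (nI = m + k):
--   C j (j < m) with incident edges (P j , P (j+1) , M j)
--   D i (i < k) : the former leaf of leg i, now carrying the loop L i,
--                 with incident edges (L i , L i , leg i).
-- Loops sit on the first k legs, so loop legs and non-loop legs are
-- each consecutive.

module Caterpillar (m k : ℕ) where
  NE : ℕ
  NE = suc m ℕ.+ (m ℕ.+ k)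

  P : Fin (suc m) → Fin NE
  P j = j ↑ˡ (m ℕ.+ k)

  M : Fin m → Fin NE
  M j = suc m ↑ʳ (j ↑ˡ k)

  L : Fin k → Fin NE
  L i = suc m ↑ʳ (m ↑ʳ i)

  -- leg number l (0 ≤ l ≤ m+1); arguments l > m+1 never occur (k ≤ m+2)
  leg : ℕ → Fin NE
  leg zero = P zero
  leg (suc j) with j <? m
  ... | yes j<m = M (fromℕ< j<m)
  ... | no _    = P (fromℕ m)

  incid : Fin (m ℕ.+ k) → Fin NE × Fin NE × Fin NE
  incid v with splitAt m v
  ... | inj₁ j = (P (inject₁ j) , P (suc j) , M j)
  ... | inj₂ i = (L i , L i , leg (toℕ i))

  graph : Graph13
  graph = record { nE = NE ; nI = m ℕ.+ k ; inc = incid }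

-- G_{h,k} (meaningful for h + k ≥ 2)
G : ℕ → ℕ → Graph13
G h k = Caterpillar.graph (h ℕ.+ k ℕ.∸ 2) k

{-# OPTIONS --safe #-}
-- Write t = 2τ.  A counted point is determined by its edge values w ∈ {0,…,t}^E; for H = ∅ or a
-- single loop the parity conditions say that every edge other than a loop carries an even value,
-- and a loop value is odd exactly when the loop is in H.  Given the values on the spine of the
-- caterpillar the loops are independent, so both counts are sums over spine configurations of
-- products of per-loop counts, and their difference replaces the factor of the marked loop by the
-- alternating count Σₓ (-1)^x of its admissible values, which is σ(y) = (-1)^(y/2) for every even
-- leg value y ≤ 2τ.  The key identity is that, for even a and b, Σₓ σ(x)·[a, b, x satisfy the
-- node conditions] = σ(a)·σ(b).  Summing the spine from the marked leg with this weight therefore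
-- collapses it node by node into a product over the other legs: a leg with a loop contributes
-- Σ_y σ(y)·#loop values = τ + 1, a leg without loop Σ_y σ(y) = [τ even].  So the difference is
-- (τ + 1)^(k-1)·[τ even]^h.
module Submission where

open import Data.Nat using (ℕ)

module Sums where

  open import Data.Nat as ℕ using (ℕ; zero; suc; _≤_; _<_; z≤n; s≤s; _^_)
  import Data.Nat.Properties as ℕP
  open import Data.Integer using (ℤ; +_; 0ℤ; 1ℤ; _+_; _*_; -_; _-_)
  import Data.Integer.Properties as ℤP
  open import Algebra.Properties.CommutativeSemigroup ℤP.+-commutativeSemigroup using (interchange)
  open import Algebra.Properties.Ring ℤP.+-*-ring using (x[y-z]≈xy-xz; [y-z]x≈yx-zx)
  open import Data.Bool using (Bool; true; false; _∧_; if_then_else_)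
  open import Data.Fin using (Fin; zero; suc; toℕ)
  open import Data.Vec using (Vec; []; _∷_; lookup; _++_)
  open import Relation.Binary.PropositionalEquality hiding ([_])
  open ≡-Reasoning

  [_] : Bool → ℤ
  [ true ] = 1ℤ
  [ false ] = 0ℤ

  [∧] : ∀ a b → [ a ∧ b ] ≡ [ a ] * [ b ]
  [∧] true b = sym (ℤP.*-identityˡ [ b ])
  [∧] false b = refl

  ΣN : ℕ → (ℕ → ℤ) → ℤ
  ΣN zero f = 0ℤ
  ΣN (suc n) f = f 0 + ΣN n (λ x → f (suc x))

  ΠN : ℕ → (ℕ → ℤ) → ℤ
  ΠN zero f = 1ℤ
  ΠN (suc n) f = f 0 * ΠN n (λ x → f (suc x))

  ΠF : (n : ℕ) → (Fin n → ℤ) → ℤ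
  ΠF zero f = 1ℤ
  ΠF (suc n) f = f zero * ΠF n (λ i → f (suc i))

  ΣN-cong : ∀ n {f g : ℕ → ℤ} → (∀ x → x < n → f x ≡ g x) → ΣN n f ≡ ΣN n g
  ΣN-cong zero eq = refl
  ΣN-cong (suc n) eq = cong₂ _+_ (eq 0 (s≤s z≤n)) (ΣN-cong n (λ x x<n → eq (suc x) (s≤s x<n)))

  ΣN-ext : ∀ n {f g : ℕ → ℤ} → (∀ x → f x ≡ g x) → ΣN n f ≡ ΣN n g
  ΣN-ext n eq = ΣN-cong n (λ x _ → eq x)

  ΣN-+ : ∀ n (f g : ℕ → ℤ) → ΣN n (λ x → f x + g x) ≡ ΣN n f + ΣN n g
  ΣN-+ zero f g = refl
  ΣN-+ (suc n) f g = begin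
    f 0 + g 0 + ΣN n (λ x → f (suc x) + g (suc x))
      ≡⟨ cong (_+_ (f 0 + g 0)) (ΣN-+ n _ _) ⟩
    f 0 + g 0 + (ΣN n (λ x → f (suc x)) + ΣN n (λ x → g (suc x)))
      ≡⟨ interchange (f 0) (g 0) _ _ ⟩
    f 0 + ΣN n (λ x → f (suc x)) + (g 0 + ΣN n (λ x → g (suc x))) ∎

  ΣN-*ˡ : ∀ n c (f : ℕ → ℤ) → ΣN n (λ x → c * f x) ≡ c * ΣN n f
  ΣN-*ˡ zero c f = sym (ℤP.*-zeroʳ c)
  ΣN-*ˡ (suc n) c f = trans (cong (_+_ (c * f 0)) (ΣN-*ˡ n c _)) (sym (ℤP.*-distribˡ-+ c (f 0) _))

  ΣN-*ʳ : ∀ n c (f : ℕ → ℤ) → ΣN n (λ x → f x * c) ≡ ΣN n f * c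
  ΣN-*ʳ n c f = begin
    ΣN n (λ x → f x * c) ≡⟨ ΣN-ext n (λ x → ℤP.*-comm (f x) c) ⟩
    ΣN n (λ x → c * f x) ≡⟨ ΣN-*ˡ n c f ⟩
    c * ΣN n f           ≡⟨ ℤP.*-comm c _ ⟩
    ΣN n f * c           ∎

  ΣN-0 : ∀ n → ΣN n (λ _ → 0ℤ) ≡ 0ℤ
  ΣN-0 zero = refl
  ΣN-0 (suc n) = trans (ℤP.+-identityˡ _) (ΣN-0 n)

  ΣN-zero : ∀ n (f : ℕ → ℤ) → (∀ x → x < n → f x ≡ 0ℤ) → ΣN n f ≡ 0ℤ
  ΣN-zero n f h = trans (ΣN-cong n h) (ΣN-0 n)

  ΣN-one : ∀ n → ΣN n (λ _ → 1ℤ) ≡ + n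
  ΣN-one zero = refl
  ΣN-one (suc n) = cong (_+_ 1ℤ) (ΣN-one n)

  ΣN-neg : ∀ n (f : ℕ → ℤ) → ΣN n (λ x → - f x) ≡ - ΣN n f
  ΣN-neg zero f = refl
  ΣN-neg (suc n) f = trans (cong (_+_ (- f 0)) (ΣN-neg n _)) (sym (ℤP.neg-distrib-+ (f 0) _))

  ΣN-- : ∀ n (f g : ℕ → ℤ) → ΣN n (λ x → f x - g x) ≡ ΣN n f - ΣN n g
  ΣN-- n f g = trans (ΣN-+ n f (λ x → - g x)) (cong (_+_ (ΣN n f)) (ΣN-neg n g))

  ΣN-swap : ∀ n m (f : ℕ → ℕ → ℤ) → ΣN n (λ x → ΣN m (λ y → f x y)) ≡ ΣN m (λ y → ΣN n (λ x → f x y))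
  ΣN-swap zero m f = sym (ΣN-0 m)
  ΣN-swap (suc n) m f = begin
    ΣN m (f 0) + ΣN n (λ x → ΣN m (f (suc x)))          ≡⟨ cong (_+_ (ΣN m (f 0))) (ΣN-swap n m (λ x → f (suc x))) ⟩
    ΣN m (f 0) + ΣN m (λ y → ΣN n (λ x → f (suc x) y)) ≡⟨ sym (ΣN-+ m _ _) ⟩
    ΣN m (λ y → f 0 y + ΣN n (λ x → f (suc x) y))      ∎

  ΣN-split : ∀ a b (f : ℕ → ℤ) → ΣN (a ℕ.+ b) f ≡ ΣN a f + ΣN b (λ x → f (a ℕ.+ x))
  ΣN-split zero b f = sym (ℤP.+-identityˡ _)
  ΣN-split (suc a) b f =
    trans (cong (_+_ (f 0)) (ΣN-split a b _)) (sym (ℤP.+-assoc (f 0) _ _))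

  ΣN-snoc : ∀ n (f : ℕ → ℤ) → ΣN (suc n) f ≡ ΣN n f + f n
  ΣN-snoc zero f = ℤP.+-comm (f 0) 0ℤ
  ΣN-snoc (suc n) f = trans (cong (_+_ (f 0)) (ΣN-snoc n _)) (sym (ℤP.+-assoc (f 0) _ _))

  ΣN-window : ∀ lo d r (f : ℕ → ℤ) → (∀ x → x < lo → f x ≡ 0ℤ) → (∀ x → lo ℕ.+ d < x → f x ≡ 0ℤ) →
    ΣN (suc (lo ℕ.+ d) ℕ.+ r) f ≡ ΣN (suc d) (λ x → f (lo ℕ.+ x))
  ΣN-window lo d r f below above = begin
    ΣN (suc (lo ℕ.+ d) ℕ.+ r) f
      ≡⟨ cong (λ n → ΣN n f) (trans (cong (ℕ._+ r) (sym (ℕP.+-suc lo d))) (ℕP.+-assoc lo (suc d) r)) ⟩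
    ΣN (lo ℕ.+ (suc d ℕ.+ r)) f
      ≡⟨ ΣN-split lo (suc d ℕ.+ r) f ⟩
    ΣN lo f + ΣN (suc d ℕ.+ r) (λ x → f (lo ℕ.+ x))
      ≡⟨ cong₂ _+_ (ΣN-zero lo f below) (ΣN-split (suc d) r (λ x → f (lo ℕ.+ x))) ⟩
    0ℤ + (ΣN (suc d) (λ x → f (lo ℕ.+ x)) + ΣN r (λ x → f (lo ℕ.+ (suc d ℕ.+ x))))
      ≡⟨ cong (λ z → 0ℤ + (ΣN (suc d) (λ x → f (lo ℕ.+ x)) + z)) (ΣN-zero r _ (λ x _ → above _ beyond)) ⟩
    0ℤ + (ΣN (suc d) (λ x → f (lo ℕ.+ x)) + 0ℤ)
      ≡⟨ trans (ℤP.+-identityˡ _) (ℤP.+-identityʳ _) ⟩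
    ΣN (suc d) (λ x → f (lo ℕ.+ x)) ∎
    where
    beyond : ∀ {x} → lo ℕ.+ d < lo ℕ.+ (suc d ℕ.+ x)
    beyond {x} = ℕP.+-monoʳ-< lo (s≤s (ℕP.m≤m+n d x))

  ΣΣ-*ˡ : ∀ B c (f : ℕ → ℕ → ℤ) → c * ΣN B (λ x → ΣN B (λ y → f x y)) ≡ ΣN B (λ x → ΣN B (λ y → c * f x y))
  ΣΣ-*ˡ B c f = trans (sym (ΣN-*ˡ B c (λ x → ΣN B (λ y → f x y)))) (ΣN-ext B (λ x → sym (ΣN-*ˡ B c (f x))))

  module BoxSums (B : ℕ) where
    SumV : (n : ℕ) → (Vec ℕ n → ℤ) → ℤ
    SumV zero f = f []
    SumV (suc n) f = ΣN B (λ a → SumV n (λ v → f (a ∷ v)))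

    SumV-ext : ∀ n {f g : Vec ℕ n → ℤ} → (∀ v → f v ≡ g v) → SumV n f ≡ SumV n g
    SumV-ext zero eq = eq []
    SumV-ext (suc n) eq = ΣN-ext B (λ a → SumV-ext n (λ v → eq (a ∷ v)))

    SumV-*ˡ : ∀ n c (f : Vec ℕ n → ℤ) → SumV n (λ v → c * f v) ≡ c * SumV n f
    SumV-*ˡ zero c f = refl
    SumV-*ˡ (suc n) c f = trans (ΣN-ext B (λ a → SumV-*ˡ n c _)) (ΣN-*ˡ B c _)

    SumV-- : ∀ n (f g : Vec ℕ n → ℤ) → SumV n (λ v → f v - g v) ≡ SumV n f - SumV n g
    SumV-- zero f g = refl
    SumV-- (suc n) f g = trans (ΣN-ext B (λ a → SumV-- n _ _)) (ΣN-- B _ _)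

    SumV-ΣN : ∀ n m (f : Vec ℕ n → ℕ → ℤ) → SumV n (λ v → ΣN m (f v)) ≡ ΣN m (λ y → SumV n (λ v → f v y))
    SumV-ΣN zero m f = refl
    SumV-ΣN (suc n) m f = trans (ΣN-ext B (λ a → SumV-ΣN n m _)) (ΣN-swap B m _)

    SumV-++ : ∀ a b (f : Vec ℕ (a ℕ.+ b) → ℤ) → SumV (a ℕ.+ b) f ≡ SumV a (λ u → SumV b (λ v → f (u ++ v)))
    SumV-++ zero b f = refl
    SumV-++ (suc a) b f = ΣN-ext B (λ x → SumV-++ a b (λ w → f (x ∷ w)))

    SumV-ΠF : ∀ k (h : Fin k → ℕ → ℤ) → SumV k (λ ls → ΠF k (λ i → h i (lookup ls i))) ≡ ΠF k (λ i → ΣN B (h i))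
    SumV-ΠF zero h = refl
    SumV-ΠF (suc k) h = begin
      ΣN B (λ a → SumV k (λ v → h zero a * ΠF k (λ i → h (suc i) (lookup v i))))
        ≡⟨ ΣN-ext B (λ a → SumV-*ˡ k (h zero a) _) ⟩
      ΣN B (λ a → h zero a * SumV k (λ v → ΠF k (λ i → h (suc i) (lookup v i))))
        ≡⟨ ΣN-*ʳ B _ (h zero) ⟩
      ΣN B (h zero) * SumV k (λ v → ΠF k (λ i → h (suc i) (lookup v i)))
        ≡⟨ cong (ΣN B (h zero) *_) (SumV-ΠF k (λ i → h (suc i))) ⟩
      ΣN B (h zero) * ΠF k (λ i → ΣN B (h (suc i))) ∎

  ΠF-toℕ : ∀ k (g : ℕ → ℤ) → ΠF k (λ i → g (toℕ i)) ≡ ΠN k g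
  ΠF-toℕ zero g = refl
  ΠF-toℕ (suc k) g = cong (g 0 *_) (ΠF-toℕ k (λ x → g (suc x)))

  ΠN-cong : ∀ n {f g : ℕ → ℤ} → (∀ x → x < n → f x ≡ g x) → ΠN n f ≡ ΠN n g
  ΠN-cong zero eq = refl
  ΠN-cong (suc n) eq = cong₂ _*_ (eq 0 (s≤s z≤n)) (ΠN-cong n (λ x x< → eq (suc x) (s≤s x<)))

  ΠN-ext : ∀ n {f g : ℕ → ℤ} → (∀ x → f x ≡ g x) → ΠN n f ≡ ΠN n g
  ΠN-ext n eq = ΠN-cong n (λ x _ → eq x)

  ΠN-ones : ∀ n (f : ℕ → ℤ) → (∀ x → f x ≡ 1ℤ) → ΠN n f ≡ 1ℤ
  ΠN-ones zero f eq = refl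
  ΠN-ones (suc n) f eq = cong₂ _*_ (eq 0) (ΠN-ones n _ (λ x → eq (suc x)))

  ΠN-zero-factor : ∀ n (f : ℕ → ℤ) → 1 ≤ n → f 0 ≡ 0ℤ → ΠN n f ≡ 0ℤ
  ΠN-zero-factor (suc n) f _ eq = cong (_* ΠN n (λ x → f (suc x))) eq

  ΠN-split : ∀ a b (f : ℕ → ℤ) → ΠN (a ℕ.+ b) f ≡ ΠN a f * ΠN b (λ x → f (a ℕ.+ x))
  ΠN-split zero b f = sym (ℤP.*-identityˡ _)
  ΠN-split (suc a) b f = trans (cong (f 0 *_) (ΠN-split a b (λ x → f (suc x)))) (sym (ℤP.*-assoc (f 0) _ _))

  ΠN-extend : ∀ k d (f : ℕ → ℤ) → (∀ x → f (k ℕ.+ x) ≡ 1ℤ) → ΠN (k ℕ.+ d) f ≡ ΠN k f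
  ΠN-extend k d f eq = trans (ΠN-split k d f) (trans (cong (ΠN k f *_) (ΠN-ones d _ eq)) (ℤP.*-identityʳ _))

  ΠN-const : ∀ n a → ΠN n (λ _ → + a) ≡ + (a ^ n)
  ΠN-const zero a = refl
  ΠN-const (suc n) a = trans (cong (+ a *_) (ΠN-const n a)) (sym (ℤP.pos-* a (a ^ n)))

  ΠN-const-except : ∀ k sp a → sp < k → ΠN k (λ l → if l ℕ.≡ᵇ sp then 1ℤ else + a) ≡ + (a ^ (k ℕ.∸ 1))
  ΠN-const-except (suc k) zero a _ = trans (ℤP.*-identityˡ _) (ΠN-const k a)
  ΠN-const-except (suc (suc k)) (suc sp) a (s≤s lt) =
    trans (cong (+ a *_) (ΠN-const-except (suc k) sp a lt)) (sym (ℤP.pos-* a (a ^ k)))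

  ΠN-difference-at : ∀ k sp (F : ℕ → Bool → ℤ) → sp < k →
    ΠN k (λ l → F l false) - ΠN k (λ l → F l (l ℕ.≡ᵇ sp))
      ≡ ΠN k (λ l → if l ℕ.≡ᵇ sp then F l false - F l true else F l false)
  ΠN-difference-at (suc k) zero F _ = sym ([y-z]x≈yx-zx (ΠN k (λ l → F (suc l) false)) (F 0 false) (F 0 true))
  ΠN-difference-at (suc k) (suc sp) F (s≤s lt) = begin
    F 0 false * ΠN k (λ l → F (suc l) false) - F 0 false * ΠN k (λ l → F (suc l) (l ℕ.≡ᵇ sp))
      ≡⟨ sym (x[y-z]≈xy-xz (F 0 false) _ _) ⟩
    F 0 false * (ΠN k (λ l → F (suc l) false) - ΠN k (λ l → F (suc l) (l ℕ.≡ᵇ sp)))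
      ≡⟨ cong (F 0 false *_) (ΠN-difference-at k sp (λ l → F (suc l)) lt) ⟩
    F 0 false * ΠN k (λ l → if l ℕ.≡ᵇ sp then F (suc l) false - F (suc l) true else F (suc l) false) ∎


module Parity where

  open Sums
  open import Data.Nat as ℕ using (ℕ; zero; suc; _≤_; z≤n; s≤s; _≤ᵇ_)
  import Data.Nat.Properties as ℕP
  import Data.Nat.Divisibility as ℕD
  import Data.Nat.DivMod as DM
  open import Data.Integer as ℤ using (+_)
  open import Data.Bool using (Bool; true; false; not; _∧_; if_then_else_; T)
  open import Data.Bool.Properties using (not-involutive)
  open import Data.Unit using (tt)
  open import Data.Empty using (⊥-elim)
  open import Relation.Binary.PropositionalEquality hiding ([_])
  open ≡-Reasoning

  even : ℕ → Bool
  even zero = true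
  even (suc zero) = false
  even (suc (suc n)) = even n

  double : ℕ → ℕ
  double zero = zero
  double (suc n) = suc (suc (double n))

  half : ℕ → ℕ
  half zero = zero
  half (suc zero) = zero
  half (suc (suc n)) = suc (half n)

  T-⇔⇒≡ : ∀ {a b} → (T a → T b) → (T b → T a) → a ≡ b
  T-⇔⇒≡ {false} {false} f g = refl
  T-⇔⇒≡ {false} {true} f g = ⊥-elim (g tt)
  T-⇔⇒≡ {true} {false} f g = ⊥-elim (f tt)
  T-⇔⇒≡ {true} {true} f g = refl

  T∧ : ∀ {a b} → T a → T b → T (a ∧ b)
  T∧ {true} {true} _ _ = tt

  T∧₁ : ∀ a b → T (a ∧ b) → T a
  T∧₁ true b _ = tt

  T∧₂ : ∀ a b → T (a ∧ b) → T b
  T∧₂ true b p = p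

  T⇒≡true : ∀ {a} → T a → a ≡ true
  T⇒≡true {true} _ = refl

  ≡true⇒T : ∀ {a} → a ≡ true → T a
  ≡true⇒T refl = tt

  ≤ᵇ⇒≤ : ∀ {m n} → T (m ≤ᵇ n) → m ≤ n
  ≤ᵇ⇒≤ {m} {n} = ℕP.≤ᵇ⇒≤ m n

  even-double : ∀ n → even (double n) ≡ true
  even-double zero = refl
  even-double (suc n) = even-double n

  half-double : ∀ n → half (double n) ≡ n
  half-double zero = refl
  half-double (suc n) = cong suc (half-double n)

  even⇒double-half : ∀ s → T (even s) → double (half s) ≡ s
  even⇒double-half zero _ = refl
  even⇒double-half (suc (suc s)) p = cong (λ x → suc (suc x)) (even⇒double-half s p)

  double≡+ : ∀ n → double n ≡ n ℕ.+ n
  double≡+ zero = refl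
  double≡+ (suc n) = cong suc (trans (cong suc (double≡+ n)) (sym (ℕP.+-suc n n)))

  double≡*2 : ∀ n → double n ≡ n ℕ.* 2
  double≡*2 n = trans (double≡+ n) (trans (cong (n ℕ.+_) (sym (ℕP.+-identityʳ n))) (ℕP.*-comm 2 n))

  double-+ : ∀ x y → double (x ℕ.+ y) ≡ double x ℕ.+ double y
  double-+ zero y = refl
  double-+ (suc x) y = cong (λ z → suc (suc z)) (double-+ x y)

  even⇒/2≡half : ∀ s → T (even s) → s ℕ./ 2 ≡ half s
  even⇒/2≡half s p = trans (cong (ℕ._/ 2) (trans (sym (even⇒double-half s p)) (double≡*2 (half s)))) (DM.m*n/n≡m (half s) 2)

  even-+ : ∀ a b → T (even a) → T (even b) → T (even (a ℕ.+ b))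
  even-+ a b pa pb = subst (λ z → T (even z)) (trans (double-+ (half a) (half b)) (cong₂ ℕ._+_ (even⇒double-half a pa) (even⇒double-half b pb)))
    (≡true⇒T (even-double (half a ℕ.+ half b)))

  double-mono-≤ : ∀ {x y} → x ≤ y → double x ≤ double y
  double-mono-≤ z≤n = z≤n
  double-mono-≤ (s≤s p) = s≤s (s≤s (double-mono-≤ p))

  double-cancel-≤ : ∀ {x y} → double x ≤ double y → x ≤ y
  double-cancel-≤ {zero} _ = z≤n
  double-cancel-≤ {suc x} {suc y} (s≤s (s≤s p)) = s≤s (double-cancel-≤ p)

  m+m≤n+n⇒m≤n : ∀ m n → m ℕ.+ m ≤ n ℕ.+ n → m ≤ n
  m+m≤n+n⇒m≤n m n p = double-cancel-≤ (subst₂ _≤_ (sym (double≡+ m)) (sym (double≡+ n)) p)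

  2∣⇒even : ∀ x → 2 ℕD.∣ x → T (even x)
  2∣⇒even zero _ = tt
  2∣⇒even (suc zero) d with ℕD.∣1⇒≡1 d
  ... | ()
  2∣⇒even (suc (suc x)) d = 2∣⇒even x (ℕD.∣m+n∣m⇒∣n d ℕD.∣-refl)

  even⇒2∣ : ∀ x → T (even x) → 2 ℕD.∣ x
  even⇒2∣ zero _ = ℕD.divides 0 refl
  even⇒2∣ (suc (suc x)) p = ℕD.∣m∣n⇒∣m+n ℕD.∣-refl (even⇒2∣ x p)

  even-suc : ∀ x → even (suc x) ≡ not (even x)
  even-suc zero = refl
  even-suc (suc x) = trans (sym (not-involutive (even x))) (cong not (sym (even-suc x)))

  double%4 : ∀ τ → double τ ℕ.% 4 ≡ (if even τ then 0 else 2)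
  double%4 zero = refl
  double%4 (suc zero) = refl
  double%4 (suc (suc τ)) = double%4 τ

  double%4≡0⇒even : ∀ τ → double τ ℕ.% 4 ≡ 0 → even τ ≡ true
  double%4≡0⇒even τ p with even τ in eq
  ... | true = refl
  ... | false with trans (sym p) (trans (double%4 τ) (cong (λ b → if b then 0 else 2) eq))
  ...   | ()

  double%4≡2⇒odd : ∀ τ → double τ ℕ.% 4 ≡ 2 → even τ ≡ false
  double%4≡2⇒odd τ p with even τ in eq
  ... | false = refl
  ... | true with trans (sym p) (trans (double%4 τ) (cong (λ b → if b then 0 else 2) eq))
  ...   | ()

  double/2+1≡suc : ∀ τ → double τ ℕ./ 2 ℕ.+ 1 ≡ suc τ
  double/2+1≡suc τ = trans (cong (ℕ._+ 1) (trans (even⇒/2≡half (double τ) (≡true⇒T (even-double τ))) (half-double τ))) (ℕP.+-comm τ 1)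


module NodeConditions (t : ℕ) where

  open Sums
  open Parity
  open import Data.Nat as ℕ using (zero; suc; _≤_; _≤ᵇ_)
  import Data.Nat.Properties as ℕP
  import Data.Nat.Divisibility as ℕD
  open import Data.Integer as ℤ using (ℤ; +_; +≤+)
  import Data.Integer.Properties as ℤP
  open import Data.Bool using (Bool; true; false; not; _∧_; if_then_else_; T)
  open import Data.Product using (_×_; _,_)
  open import Function.Bundles using (_⇔_; mk⇔; Equivalence)
  open import Relation.Binary.PropositionalEquality hiding ([_])

  -- The inequalities of t·Q_G at an internal node with edge values a, b, c, the bound
  -- z_v = (a + b + c)/2 ≤ t being stated as a + b + c ≤ 2t.  Conditions are booleans so that
  -- lattice point counts become sums of indicators [_].
  nodeOK : ℕ → ℕ → ℕ → Bool
  nodeOK a b c = (a ≤ᵇ b ℕ.+ c) ∧ ((b ≤ᵇ a ℕ.+ c) ∧ ((c ≤ᵇ a ℕ.+ b) ∧ (a ℕ.+ b ℕ.+ c ≤ᵇ t ℕ.+ t)))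

  loopNodeOK : ℕ → ℕ → Bool
  loopNodeOK x y = (y ≤ᵇ x ℕ.+ x) ∧ (x ℕ.+ x ℕ.+ y ≤ᵇ t ℕ.+ t)

  parityOK : Bool → ℕ → Bool
  parityOK b x = if b then not (even x) else even x

  IntNode : ℕ → ℕ → ℕ → ℤ → Set
  IntNode a b c zv = (+ a ℤ.≤ + b ℤ.+ + c) × (+ b ℤ.≤ + a ℤ.+ + c) × (+ c ℤ.≤ + a ℤ.+ + b)
    × (+ a ℤ.+ + b ℤ.+ + c ≡ + 2 ℤ.* zv) × (zv ℤ.≤ + t)

  half≤⇔≤+ : ∀ s → T (even s) → (half s ≤ t) ⇔ (s ≤ t ℕ.+ t)
  half≤⇔≤+ s p = mk⇔ (λ q → subst₂ _≤_ (even⇒double-half s p) (double≡+ t) (double-mono-≤ q))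
                   (λ q → double-cancel-≤ (subst₂ _≤_ (sym (even⇒double-half s p)) (sym (double≡+ t)) q))

  NodeIneqs : ℕ → ℕ → ℕ → Set
  NodeIneqs a b c = (a ≤ b ℕ.+ c) × (b ≤ a ℕ.+ c) × (c ≤ a ℕ.+ b) × (a ℕ.+ b ℕ.+ c ≤ t ℕ.+ t)

  nodeOK-elim : ∀ a b c → T (nodeOK a b c) → NodeIneqs a b c
  nodeOK-elim a b c q = ≤ᵇ⇒≤ (T∧₁ x1 _ q) , ≤ᵇ⇒≤ (T∧₁ x2 _ q2) , ≤ᵇ⇒≤ (T∧₁ x3 _ q3) , ≤ᵇ⇒≤ (T∧₂ x3 x4 q3)
    where
    x1 = a ≤ᵇ b ℕ.+ c
    x2 = b ≤ᵇ a ℕ.+ c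
    x3 = c ≤ᵇ a ℕ.+ b
    x4 = a ℕ.+ b ℕ.+ c ≤ᵇ t ℕ.+ t
    q2 = T∧₂ x1 (x2 ∧ (x3 ∧ x4)) q
    q3 = T∧₂ x2 (x3 ∧ x4) q2

  nodeOK-intro : ∀ a b c → NodeIneqs a b c → T (nodeOK a b c)
  nodeOK-intro a b c (h0 , h1 , h2 , h3) = T∧ (ℕP.≤⇒≤ᵇ h0) (T∧ (ℕP.≤⇒≤ᵇ h1) (T∧ (ℕP.≤⇒≤ᵇ h2) (ℕP.≤⇒≤ᵇ h3)))

  loopNodeOK-elim : ∀ x y → T (loopNodeOK x y) → (y ≤ x ℕ.+ x) × (x ℕ.+ x ℕ.+ y ≤ t ℕ.+ t)
  loopNodeOK-elim x y q = ≤ᵇ⇒≤ (T∧₁ (y ≤ᵇ x ℕ.+ x) _ q) , ≤ᵇ⇒≤ (T∧₂ (y ≤ᵇ x ℕ.+ x) (x ℕ.+ x ℕ.+ y ≤ᵇ t ℕ.+ t) q)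

  loopNodeOK-intro : ∀ x y → (y ≤ x ℕ.+ x) × (x ℕ.+ x ℕ.+ y ≤ t ℕ.+ t) → T (loopNodeOK x y)
  loopNodeOK-intro x y (h0 , h1) = T∧ (ℕP.≤⇒≤ᵇ h0) (ℕP.≤⇒≤ᵇ h1)

  IntNode⇒nodeOK : ∀ a b c → T (even (a ℕ.+ b ℕ.+ c)) → IntNode a b c (+ ((a ℕ.+ b ℕ.+ c) ℕ./ 2)) → T (nodeOK a b c)
  IntNode⇒nodeOK a b c p (+≤+ h0 , +≤+ h1 , +≤+ h2 , _ , +≤+ h3) =
    nodeOK-intro a b c (h0 , h1 , h2 , Equivalence.to (half≤⇔≤+ _ p) (subst (_≤ t) (even⇒/2≡half _ p) h3))

  nodeOK⇒IntNode : ∀ a b c → T (even (a ℕ.+ b ℕ.+ c)) → T (nodeOK a b c) → IntNode a b c (+ ((a ℕ.+ b ℕ.+ c) ℕ./ 2))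
  nodeOK⇒IntNode a b c p q with nodeOK-elim a b c q
  ... | h0 , h1 , h2 , h3 = +≤+ h0 , +≤+ h1 , +≤+ h2 ,
    eqn , +≤+ (subst (_≤ t) (sym (even⇒/2≡half _ p)) (Equivalence.from (half≤⇔≤+ _ p) h3))
    where
    s = a ℕ.+ b ℕ.+ c
    eqn : + s ≡ + 2 ℤ.* + (s ℕ./ 2)
    eqn = trans (cong +_ (trans (sym (even⇒double-half s p)) (trans (double≡*2 (half s)) (trans (ℕP.*-comm (half s) 2)
             (cong (2 ℕ.*_) (sym (even⇒/2≡half s p))))))) (ℤP.pos-* 2 (s ℕ./ 2))

  nodeOK⇒loopNodeOK : ∀ x y → T (nodeOK x x y) → T (loopNodeOK x y)
  nodeOK⇒loopNodeOK x y q with nodeOK-elim x x y q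
  ... | _ , _ , h2 , h3 = loopNodeOK-intro x y (h2 , h3)

  loopNodeOK⇒nodeOK : ∀ x y → T (loopNodeOK x y) → T (nodeOK x x y)
  loopNodeOK⇒nodeOK x y q with loopNodeOK-elim x y q
  ... | h2 , h3 = nodeOK-intro x x y (ℕP.m≤m+n x y , ℕP.m≤m+n x y , h2 , h3)

  𝟙ᵇ : Bool → ℤ
  𝟙ᵇ b = if b then + 1 else + 0

  2∣⇒parityOK : ∀ b x → 2 ℕD.∣ ℤ.∣ + x ℤ.- 𝟙ᵇ b ∣ → T (parityOK b x)
  2∣⇒parityOK false x d = 2∣⇒even x (subst (2 ℕD.∣_) (ℕP.+-identityʳ x) d)
  2∣⇒parityOK true zero d with ℕD.∣1⇒≡1 d
  ... | ()
  2∣⇒parityOK true (suc x) d = subst T (cong not (sym (even-suc x))) (notT (2∣⇒even x (subst (2 ℕD.∣_) (∣1+x-1∣≡x x) d)))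
    where
    ∣1+x-1∣≡x : ∀ x → ℤ.∣ + suc x ℤ.- + 1 ∣ ≡ x
    ∣1+x-1∣≡x x = cong ℤ.∣_∣ (ℤP.[1+m]⊖[1+n]≡m⊖n x 0)
    notT : ∀ {b} → T b → T (not (not b))
    notT {true} p = p

  parityOK⇒2∣ : ∀ b x → T (parityOK b x) → 2 ℕD.∣ ℤ.∣ + x ℤ.- 𝟙ᵇ b ∣
  parityOK⇒2∣ false x p = subst (2 ℕD.∣_) (sym (ℕP.+-identityʳ x)) (even⇒2∣ x p)
  parityOK⇒2∣ true zero ()
  parityOK⇒2∣ true (suc x) p = subst (2 ℕD.∣_) (sym (cong ℤ.∣_∣ (ℤP.[1+m]⊖[1+n]≡m⊖n x 0))) (even⇒2∣ x (unnot (subst T (cong not (even-suc x)) p)))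
    where
    unnot : ∀ {b} → T (not (not b)) → T b
    unnot {true} p = p

  nodeOK-swap : ∀ a b c → nodeOK a b c ≡ nodeOK b a c
  nodeOK-swap a b c = T-⇔⇒≡ (f a b c) (f b a c)
    where
    f : ∀ a b c → T (nodeOK a b c) → T (nodeOK b a c)
    f a b c q with nodeOK-elim a b c q
    ... | h0 , h1 , h2 , h3 = nodeOK-intro b a c (h1 , h0 , subst (c ≤_) (ℕP.+-comm a b) h2 ,
            subst (_≤ t ℕ.+ t) (cong (ℕ._+ c) (ℕP.+-comm a b)) h3)

  nodeOK-rotate : ∀ a b c → nodeOK a b c ≡ nodeOK c a b
  nodeOK-rotate a b c = T-⇔⇒≡ (f a b c) (λ q → f b c a (f c a b q))
    where
    e : ∀ a b c → a ℕ.+ b ℕ.+ c ≡ c ℕ.+ a ℕ.+ b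
    e a b c = trans (ℕP.+-comm (a ℕ.+ b) c) (sym (ℕP.+-assoc c a b))
    f : ∀ a b c → T (nodeOK a b c) → T (nodeOK c a b)
    f a b c q with nodeOK-elim a b c q
    ... | h0 , h1 , h2 , h3 = nodeOK-intro c a b (h2 , subst (a ≤_) (ℕP.+-comm b c) h0 ,
            subst (b ≤_) (ℕP.+-comm a c) h1 , subst (_≤ t ℕ.+ t) (e a b c) h3)


module LatticePoints where

  open import Defs
  open Sums
  open Parity using (m+m≤n+n⇒m≤n)
  open import Data.Nat as ℕ using (ℕ; zero; suc; z≤n; s≤s)
  import Data.Nat.Properties as ℕP
  import Data.Nat.Divisibility as ℕD
  import Data.Nat.DivMod as DM
  open import Data.Integer as ℤ using (ℤ; +_; -[1+_]; 0ℤ; 1ℤ; _+_; _*_; -_; _-_; _≤_; +≤+; -≤+)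
  import Data.Integer.Properties as ℤP
  open import Data.Integer.Tactic.RingSolver
  open import Data.Bool using (true; false)
  open import Data.Fin using (Fin; zero; suc)
  import Data.Fin.Properties as FinP
  open import Data.Fin.Subset using (Subset)
  open import Data.Vec as V using (Vec; []; _∷_; lookup; tabulate)
  import Data.Vec.Properties as VP
  open import Data.List as L using (List; []; _∷_; map; filter; length; upTo; applyUpTo; cartesianProductWith; _++_)
  open import Data.List.Membership.Propositional using (_∈_)
  open import Data.List.Membership.Propositional.Properties
  open import Data.List.Relation.Unary.Unique.Propositional using (Unique)
  import Data.List.Relation.Unary.Unique.Propositional.Properties as UP
  open import Data.Product using (Σ; _×_; _,_; proj₁; proj₂)
  open import Data.Sum using (_⊎_; inj₁; inj₂)
  open import Relation.Nullary using (Dec; does)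
  open import Relation.Nullary.Decidable using (_×-dec_)
  open import Relation.Unary using (Decidable)
  open import Relation.Binary.PropositionalEquality hiding ([_])
  open ≡-Reasoning

  SumL : {A : Set} → (A → ℤ) → List A → ℤ
  SumL f [] = 0ℤ
  SumL f (x ∷ xs) = f x + SumL f xs

  SumL-++ : {A : Set} (f : A → ℤ) (xs ys : List A) → SumL f (xs ++ ys) ≡ SumL f xs + SumL f ys
  SumL-++ f [] ys = sym (ℤP.+-identityˡ _)
  SumL-++ f (x ∷ xs) ys = trans (cong (_+_ (f x)) (SumL-++ f xs ys)) (sym (ℤP.+-assoc (f x) (SumL f xs) (SumL f ys)))

  SumL-map : {A C : Set} (f : C → ℤ) (g : A → C) (xs : List A) → SumL f (map g xs) ≡ SumL (λ x → f (g x)) xs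
  SumL-map f g [] = refl
  SumL-map f g (x ∷ xs) = cong (_+_ (f (g x))) (SumL-map f g xs)

  SumL-applyUpTo : {A : Set} (f : A → ℤ) (g : ℕ → A) (n : ℕ) → SumL f (applyUpTo g n) ≡ ΣN n (λ x → f (g x))
  SumL-applyUpTo f g zero = refl
  SumL-applyUpTo f g (suc n) = cong (_+_ (f (g 0))) (SumL-applyUpTo f (λ x → g (suc x)) n)

  SumL-cPW : {A C D : Set} (f : D → ℤ) (h : A → C → D) (xs : List A) (ys : List C) →
    SumL f (cartesianProductWith h xs ys) ≡ SumL (λ x → SumL (λ y → f (h x y)) ys) xs
  SumL-cPW f h [] ys = refl
  SumL-cPW f h (x ∷ xs) ys = begin
    SumL f (map (h x) ys ++ cartesianProductWith h xs ys) ≡⟨ SumL-++ f (map (h x) ys) (cartesianProductWith h xs ys) ⟩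
    SumL f (map (h x) ys) + SumL f (cartesianProductWith h xs ys) ≡⟨ cong₂ _+_ (SumL-map f (h x) ys) (SumL-cPW f h xs ys) ⟩
    _ ∎

  SumL-ext : {A : Set} {f g : A → ℤ} (xs : List A) → (∀ x → f x ≡ g x) → SumL f xs ≡ SumL g xs
  SumL-ext [] eq = refl
  SumL-ext (x ∷ xs) eq = cong₂ _+_ (eq x) (SumL-ext xs eq)

  indicator : {P : Set} → Dec P → ℤ
  indicator d = [ does d ]

  length-filter : {A : Set} {P : A → Set} (P? : Decidable P) (xs : List A) →
    + length (filter P? xs) ≡ SumL (λ x → indicator (P? x)) xs
  length-filter P? [] = refl
  length-filter P? (x ∷ xs) with does (P? x)
  ... | false = trans (length-filter P? xs) (sym (ℤP.+-identityˡ _))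
  ... | true = trans (cong (λ z → 1ℤ + z) (length-filter P? xs)) refl

  module BoxVectors (B : ℕ) where
    open BoxSums B public

    boxVectors : (n : ℕ) → List (Vec ℕ n)
    boxVectors zero = [] ∷ []
    boxVectors (suc n) = cartesianProductWith _∷_ (upTo B) (boxVectors n)

    SumL-boxVectors : ∀ n (f : Vec ℕ n → ℤ) → SumL f (boxVectors n) ≡ SumV n f
    SumL-boxVectors zero f = ℤP.+-identityʳ (f [])
    SumL-boxVectors (suc n) f = begin
      SumL f (cartesianProductWith _∷_ (upTo B) (boxVectors n)) ≡⟨ SumL-cPW f _∷_ (upTo B) (boxVectors n) ⟩
      SumL (λ a → SumL (λ v → f (a ∷ v)) (boxVectors n)) (upTo B) ≡⟨ SumL-applyUpTo _ (λ x → x) B ⟩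
      ΣN B (λ a → SumL (λ v → f (a ∷ v)) (boxVectors n)) ≡⟨ ΣN-ext B (λ a → SumL-boxVectors n (λ v → f (a ∷ v))) ⟩
      SumV (suc n) f ∎

    boxVectors-unique : ∀ n → Unique (boxVectors n)
    boxVectors-unique zero = All.[] AP.∷ AP.[]
      where
      import Data.List.Relation.Unary.AllPairs as AP
      import Data.List.Relation.Unary.All as All
    boxVectors-unique (suc n) = UP.cartesianProductWith⁺ _∷_ inj (UP.upTo⁺ B) (boxVectors-unique n)
      where
      inj : ∀ {w x : ℕ} {y z : Vec ℕ n} → w ∷ y ≡ x ∷ z → w ≡ x × y ≡ z
      inj refl = refl , refl

    boxVectors-complete : ∀ n (v : Vec ℕ n) → (∀ i → lookup v i ℕ.< B) → v ∈ boxVectors n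
    boxVectors-complete zero [] _ = here refl
      where open import Data.List.Relation.Unary.Any using (here)
    boxVectors-complete (suc n) (x ∷ v) bd = ∈-cartesianProductWith⁺ _∷_ (∈-upTo⁺ (bd zero)) (boxVectors-complete n v (λ i → bd (suc i)))

  -- Definitionally the node condition of InTQ, which Defs keeps local.

  NodeAt : ∀ {n} (w : Vec ℤ n) (t : ℕ) → Fin n × Fin n × Fin n → ℤ → Set
  NodeAt w t (a , b , c) zv =
      let wa = lookup w a ; wb = lookup w b ; wc = lookup w c in
      (wa ≤ wb + wc) × (wb ≤ wa + wc) × (wc ≤ wa + wb)
      × (wa + wb + wc ≡ + 2 * zv) × (zv ≤ + t)

  NodeAt? : ∀ {n} (w : Vec ℤ n) (t : ℕ) tr zv → Dec (NodeAt w t tr zv)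
  NodeAt? w t (a , b , c) zv =
    (lookup w a ℤP.≤? lookup w b + lookup w c) ×-dec
    ((lookup w b ℤP.≤? lookup w a + lookup w c) ×-dec
    ((lookup w c ℤP.≤? lookup w a + lookup w b) ×-dec
    ((lookup w a + lookup w b + lookup w c ℤP.≟ + 2 * zv) ×-dec
    (zv ℤP.≤? + t))))

  InTQ? : ∀ t G w z → Dec (InTQ t G w z)
  InTQ? t G w z = FinP.all? (λ v → NodeAt? w t (inc G v) (lookup z v))

  VolPoint? : ∀ t G H (x : Vec ℤ (nE G) × Vec ℤ (nI G)) → Dec (VolPoint t G H x)
  VolPoint? t G H (w , z) = InTQ? t G w z ×-dec FinP.all? (λ e → 2 ℕD.∣? ℤ.∣ lookup w e - 𝟙 H e ∣)

  cancelˡ : ∀ x {a b} → x + a ≤ x + b → a ≤ b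
  cancelˡ x {a} {b} p = subst₂ _≤_ (e a) (e b) (ℤP.+-monoʳ-≤ (- x) p)
    where
    r : ∀ x a → - x + (x + a) ≡ a
    r = solve-∀
    e : ∀ a → - x + (x + a) ≡ a
    e a = r x a

  0≤a+a : ∀ a → + 0 ≤ a + a → + 0 ≤ a
  0≤a+a (+ n) _ = +≤+ z≤n
  0≤a+a -[1+ n ] ()

  aa≤tt : ∀ a t → a + a ≤ + t + + t → a ≤ + t
  aa≤tt (+ n) t (+≤+ p) = +≤+ (m+m≤n+n⇒m≤n n t p)
  aa≤tt -[1+ n ] t _ = -≤+

  node-bound₁ : ∀ t {a b c z} → a ≤ b + c → b ≤ a + c → c ≤ a + b → a + b + c ≡ + 2 * z → z ≤ + t →
    (+ 0 ≤ a) × (a ≤ + t)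
  node-bound₁ t {a} {b} {c} {z} h0 h1 h2 eq zt = lower , upper
    where
    r1' : ∀ a b c → (a + c) + (a + b) ≡ (b + c) + (a + a)
    r1' = solve-∀
    r2' : ∀ x → x + + 0 ≡ x
    r2' = solve-∀
    lower : + 0 ≤ a
    lower = 0≤a+a a (cancelˡ (b + c) (subst₂ _≤_ (sym (r2' (b + c))) (r1' a b c) (ℤP.+-mono-≤ h1 h2)))
    r3' : ∀ a b c → a + (b + c) ≡ a + b + c
    r3' = solve-∀
    r4' : ∀ z → + 2 * z ≡ z + z
    r4' = solve-∀
    upper : a ≤ + t
    upper = aa≤tt a t (ℤP.≤-trans (ℤP.+-monoʳ-≤ a h0)
      (ℤP.≤-trans (ℤP.≤-reflexive (trans (r3' a b c) (trans eq (r4' z)))) (ℤP.+-mono-≤ zt zt)))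

  node-bound₂ : ∀ t {a b c z} → a ≤ b + c → b ≤ a + c → c ≤ a + b → a + b + c ≡ + 2 * z → z ≤ + t →
    (+ 0 ≤ b) × (b ≤ + t)
  node-bound₂ t {a} {b} {c} {z} h0 h1 h2 eq zt =
    node-bound₁ t h1 h0 (subst (c ≤_) (ℤP.+-comm a b) h2) (trans (cong (_+ c) (ℤP.+-comm b a)) eq) zt

  node-bound₃ : ∀ t {a b c z} → a ≤ b + c → b ≤ a + c → c ≤ a + b → a + b + c ≡ + 2 * z → z ≤ + t →
    (+ 0 ≤ c) × (c ≤ + t)
  node-bound₃ t {a} {b} {c} {z} h0 h1 h2 eq zt =
    node-bound₁ t h2 (subst (a ≤_) (ℤP.+-comm b c) h0) (subst (b ≤_) (ℤP.+-comm a c) h1) (trans (rr a b c) eq) zt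
    where
    rr : ∀ a b c → c + a + b ≡ a + b + c
    rr = solve-∀

  IncidentTo : ∀ {n} → Fin n → Fin n × Fin n × Fin n → Set
  IncidentTo e tr = e ≡ proj₁ tr ⊎ e ≡ proj₁ (proj₂ tr) ⊎ e ≡ proj₂ (proj₂ tr)

  -- Since every edge lies at an internal node, the node inequalities force 0 ≤ w_e ≤ t, and z
  -- is determined by w; so the counted points are the encodings of the box vectors in
  -- {0..t}^E that satisfy VolPoint.
  module Enumeration (t : ℕ) (Gr : Graph13) (H : Subset (nE Gr))
              (incident-node : ∀ e → Σ (Fin (nI Gr)) λ v → IncidentTo e (inc Gr v)) where
    open BoxVectors (suc t) public

    halfSum : Vec ℕ (nE Gr) → Fin (nE Gr) × Fin (nE Gr) × Fin (nE Gr) → ℕ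
    halfSum w tr = (lookup w (proj₁ tr) ℕ.+ lookup w (proj₁ (proj₂ tr)) ℕ.+ lookup w (proj₂ (proj₂ tr))) ℕ./ 2

    encode : Vec ℕ (nE Gr) → Vec ℤ (nE Gr) × Vec ℤ (nI Gr)
    encode w = V.map +_ w , tabulate (λ v → + halfSum w (inc Gr v))

    IsPoint : Vec ℕ (nE Gr) → Set
    IsPoint w = VolPoint t Gr H (encode w)

    IsPoint? : Decidable IsPoint
    IsPoint? w = VolPoint? t Gr H (encode w)

    points : List (Vec ℤ (nE Gr) × Vec ℤ (nI Gr))
    points = map encode (filter IsPoint? (boxVectors (nE Gr)))

    lookup-ext : ∀ {A : Set} {n} (xs ys : Vec A n) → (∀ i → lookup xs i ≡ lookup ys i) → xs ≡ ys
    lookup-ext xs ys eq = trans (sym (VP.tabulate∘lookup xs)) (trans (VP.tabulate-cong eq) (VP.tabulate∘lookup ys))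

    encode-injective : ∀ {x y} → encode x ≡ encode y → x ≡ y
    encode-injective {x} {y} eq = lookup-ext x y (λ i → ℤP.+-injective (trans (sym (VP.lookup-map i +_ x))
                           (trans (cong (λ w → lookup w i) (cong proj₁ eq)) (VP.lookup-map i +_ y))))

    edge-bounds : ∀ (w : Vec ℤ (nE Gr)) z → InTQ t Gr w z → ∀ e → (+ 0 ≤ lookup w e) × (lookup w e ≤ + t)
    edge-bounds w z q e with incident-node e
    ... | v , p with q v
    ... | h0 , h1 , h2 , eq , zt with p
    ... | inj₁ refl = node-bound₁ t h0 h1 h2 eq zt
    ... | inj₂ (inj₁ refl) = node-bound₂ t h0 h1 h2 eq zt
    ... | inj₂ (inj₂ refl) = node-bound₃ t h0 h1 h2 eq zt

    2*z≡s⇒z≡s/2 : ∀ (s : ℕ) (z : ℤ) → + s ≡ + 2 * z → z ≡ + (s ℕ./ 2)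
    2*z≡s⇒z≡s/2 s (+ n) eq = cong +_ (sym (trans (cong (ℕ._/ 2) (ℤP.+-injective eq')) (DM.m*n/n≡m n 2)))
      where
      eq' : + s ≡ + (n ℕ.* 2)
      eq' = trans eq (trans (sym (ℤP.pos-* 2 n)) (cong +_ (ℕP.*-comm 2 n)))
    2*z≡s⇒z≡s/2 s -[1+ n ] ()

    complete : ∀ x → VolPoint t Gr H x → x ∈ points
    complete (w' , z') vp@(q , par) = subst (_∈ points) (sym eqx) (∈-map⁺ encode (∈-filter⁺ IsPoint? w∈ (subst (VolPoint t Gr H) eqx vp)))
      where
      w : Vec ℕ (nE Gr)
      w = tabulate (λ e → ℤ.∣ lookup w' e ∣)
      lw : ∀ e → + lookup w e ≡ lookup w' e
      lw e = trans (cong +_ (VP.lookup∘tabulate _ e)) (ℤP.0≤i⇒+∣i∣≡i (proj₁ (edge-bounds w' z' q e)))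
      eqw : V.map +_ w ≡ w'
      eqw = lookup-ext _ _ (λ e → trans (VP.lookup-map e +_ w) (lw e))
      eqz : tabulate (λ v → + halfSum w (inc Gr v)) ≡ z'
      eqz = lookup-ext _ _ (λ v → trans (VP.lookup∘tabulate _ v) (sym (zeq v)))
        where
        zeq : ∀ v → lookup z' v ≡ + halfSum w (inc Gr v)
        zeq v = 2*z≡s⇒z≡s/2 (lookup w (proj₁ (inc Gr v)) ℕ.+ lookup w (proj₁ (proj₂ (inc Gr v))) ℕ.+ lookup w (proj₂ (proj₂ (inc Gr v))))
                  (lookup z' v)
                  (trans (cong₂ _+_ (cong₂ _+_ (lw (proj₁ (inc Gr v))) (lw (proj₁ (proj₂ (inc Gr v))))) (lw (proj₂ (proj₂ (inc Gr v)))))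
                    (proj₁ (proj₂ (proj₂ (proj₂ (q v))))))
      eqx : (w' , z') ≡ encode w
      eqx = sym (cong₂ _,_ eqw eqz)
      w∈ : w ∈ boxVectors (nE Gr)
      w∈ = boxVectors-complete _ w (λ e → subst (ℕ._< suc t) (sym (VP.lookup∘tabulate _ e))
             (s≤s (ℤP.drop‿+≤+ (subst (_≤ + t) (sym (ℤP.0≤i⇒+∣i∣≡i (proj₁ (edge-bounds w' z' q e)))) (proj₂ (edge-bounds w' z' q e))))))

    sound : ∀ x → x ∈ points → VolPoint t Gr H x
    sound x x∈ with ∈-map⁻ encode x∈
    ... | w , w∈ , refl = proj₂ (∈-filter⁻ IsPoint? {xs = boxVectors (nE Gr)} w∈)

    points-enumerate : Enumerates (VolPoint t Gr H) points
    points-enumerate = record { unique = UP.map⁺ encode-injective (UP.filter⁺ IsPoint? (boxVectors-unique _)) ; sound = sound ; complete = complete }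

    points-volIs : VolIs t Gr H (length points)
    points-volIs = points , points-enumerate , refl

    length-points : + length points ≡ SumV (nE Gr) (λ w → indicator (IsPoint? w))
    length-points = trans (cong +_ (L.length-map encode (filter IsPoint? (boxVectors (nE Gr))))) (trans (length-filter IsPoint? (boxVectors (nE Gr))) (SumL-boxVectors (nE Gr) (λ w → indicator (IsPoint? w))))
      where import Data.List.Properties as L


module CaterpillarPoints where

  open import Defs
  open Sums
  open Parity
  open LatticePoints
  open import Data.Nat as ℕ using (ℕ; zero; suc; _≤_; _<_; s≤s; _<?_)
  import Data.Nat.Properties as ℕP
  import Data.Nat.Divisibility as ℕD
  open import Data.Integer as ℤ using (ℤ; +_)
  open import Data.Bool using (Bool; true; false; _∧_; T)
  open import Data.Unit using (tt)
  open import Data.Empty using (⊥-elim)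
  open import Data.Fin using (Fin; zero; suc; _↑ˡ_; _↑ʳ_; inject₁; toℕ; fromℕ; fromℕ<; splitAt)
  import Data.Fin.Properties as FinP
  open import Data.Fin.Subset using (Subset)
  open import Data.Vec as V using (Vec; []; _∷_; lookup; tabulate; _++_)
  import Data.Vec.Properties as VP
  open import Data.Product using (Σ; _×_; _,_; proj₁; proj₂)
  open import Data.Sum using (inj₁; inj₂)
  open import Relation.Nullary using (yes; no; Dec)
  open import Relation.Binary.PropositionalEquality hiding ([_])

  -- The value on leg l (the edge leg l of Defs) when the path edges P 0, …, P n carry ps
  -- and the middle legs M 0, …, M (n-1) carry ms.
  legValue : ∀ {n} → ℕ → Vec ℕ (suc n) → Vec ℕ n → ℕ
  legValue zero (p ∷ _) _ = p
  legValue (suc j) (p ∷ []) [] = p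
  legValue (suc zero) (p ∷ p' ∷ ps) (μ ∷ ms) = μ
  legValue (suc (suc j)) (p ∷ p' ∷ ps) (μ ∷ ms) = legValue (suc j) (p' ∷ ps) ms

  legValue-middle : ∀ n j (j<n : j < n) (ps : Vec ℕ (suc n)) (ms : Vec ℕ n) → legValue (suc j) ps ms ≡ lookup ms (fromℕ< j<n)
  legValue-middle (suc n) zero (s≤s _) (p ∷ p' ∷ ps) (μ ∷ ms) = refl
  legValue-middle (suc n) (suc j) (s≤s j<n) (p ∷ p' ∷ ps) (μ ∷ ms) = legValue-middle n j j<n (p' ∷ ps) ms

  legValue-last : ∀ n j → n ≤ j → (ps : Vec ℕ (suc n)) (ms : Vec ℕ n) → legValue (suc j) ps ms ≡ lookup ps (fromℕ n)
  legValue-last zero j _ (p ∷ []) [] = refl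
  legValue-last (suc n) (suc j) (s≤s le) (p ∷ p' ∷ ps) (μ ∷ ms) = legValue-last n j le (p' ∷ ps) ms

  allFin : (n : ℕ) → (Fin n → Bool) → Bool
  allFin zero f = true
  allFin (suc n) f = f zero ∧ allFin n (λ i → f (suc i))

  allFin-intro : ∀ n (f : Fin n → Bool) → (∀ i → T (f i)) → T (allFin n f)
  allFin-intro zero f h = tt
  allFin-intro (suc n) f h = T∧ (h zero) (allFin-intro n (λ i → f (suc i)) (λ i → h (suc i)))

  allFin-elim : ∀ n (f : Fin n → Bool) → T (allFin n f) → ∀ i → T (f i)
  allFin-elim (suc n) f q zero = T∧₁ (f zero) _ q
  allFin-elim (suc n) f q (suc i) = allFin-elim n (λ i → f (suc i)) (T∧₂ (f zero) (allFin n (λ i → f (suc i))) q) i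

  ∀-↑ˡ-↑ʳ : ∀ a b {P : Fin (a ℕ.+ b) → Set} → (∀ j → P (j ↑ˡ b)) → (∀ i → P (a ↑ʳ i)) → ∀ v → P v
  ∀-↑ˡ-↑ʳ a b {P} f g v with splitAt a v in eq
  ... | inj₁ j = subst P (FinP.splitAt⁻¹-↑ˡ eq) (f j)
  ... | inj₂ i = subst P (FinP.splitAt⁻¹-↑ʳ eq) (g i)

  indicator-reflects : {Q : Set} (d : Dec Q) (b : Bool) → (Q → T b) → (T b → Q) → indicator d ≡ [ b ]
  indicator-reflects (yes q) b f g = sym (cong [_] (T⇒≡true (f q)))
  indicator-reflects (no nq) true f g = ⊥-elim (nq (g tt))
  indicator-reflects (no nq) false f g = refl

  module SpineConditions (t : ℕ) where
    open NodeConditions t public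

    -- Path edges and middle legs never lie in H, so their parity condition says they are even.
    spineOK : ∀ {n} → ℕ → Vec ℕ n → Vec ℕ n → Bool
    spineOK p [] [] = true
    spineOK p (p' ∷ ps) (μ ∷ ms) = (even p' ∧ (even μ ∧ nodeOK p p' μ)) ∧ spineOK p' ps ms

    spineOK-intro : ∀ n p (ps : Vec ℕ n) ms → (∀ j → T (even (lookup ps j))) → (∀ j → T (even (lookup ms j)))
       → (∀ j → T (nodeOK (lookup (p ∷ ps) (inject₁ j)) (lookup (p ∷ ps) (suc j)) (lookup ms j))) → T (spineOK p ps ms)
    spineOK-intro zero p [] [] _ _ _ = tt
    spineOK-intro (suc n) p (p' ∷ ps) (μ ∷ ms) eP eM tr =
      T∧ (T∧ (eP zero) (T∧ (eM zero) (tr zero))) (spineOK-intro n p' ps ms (λ j → eP (suc j)) (λ j → eM (suc j)) (λ j → tr (suc j)))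

    spineOK-elim : ∀ n p (ps : Vec ℕ n) ms → T (spineOK p ps ms) →
       (∀ j → T (even (lookup ps j))) × (∀ j → T (even (lookup ms j)))
       × (∀ j → T (nodeOK (lookup (p ∷ ps) (inject₁ j)) (lookup (p ∷ ps) (suc j)) (lookup ms j)))
    spineOK-elim zero p [] [] _ = (λ ()) , (λ ()) , (λ ())
    spineOK-elim (suc n) p (p' ∷ ps) (μ ∷ ms) q = eP , eM , tr
      where
      a = even p' ∧ (even μ ∧ nodeOK p p' μ)
      b = spineOK p' ps ms
      qa = T∧₁ a b q
      qb = T∧₂ a b q
      rec = spineOK-elim n p' ps ms qb
      e1 = T∧₁ (even p') (even μ ∧ nodeOK p p' μ) qa
      e23 = T∧₂ (even p') (even μ ∧ nodeOK p p' μ) qa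
      e2 = T∧₁ (even μ) (nodeOK p p' μ) e23
      e3 = T∧₂ (even μ) (nodeOK p p' μ) e23
      eP : ∀ j → T (even (lookup (p' ∷ ps) j))
      eP zero = e1
      eP (suc j) = proj₁ rec j
      eM : ∀ j → T (even (lookup (μ ∷ ms) j))
      eM zero = e2
      eM (suc j) = proj₁ (proj₂ rec) j
      tr : ∀ j → T (nodeOK (lookup (p ∷ p' ∷ ps) (inject₁ j)) (lookup (p ∷ p' ∷ ps) (suc j)) (lookup (μ ∷ ms) j))
      tr zero = e3
      tr (suc j) = proj₂ (proj₂ rec) j

    loopOK : Bool → ℕ → ℕ → Bool
    loopOK b x y = loopNodeOK x y ∧ parityOK b x


  module Coordinates (t m k : ℕ) where
    open Caterpillar m k public
    open SpineConditions t public

    incid-spine : ∀ (j : Fin m) → incid (j ↑ˡ k) ≡ (P (inject₁ j) , P (suc j) , M j)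
    incid-spine j rewrite FinP.splitAt-↑ˡ m j k = refl

    incid-loop : ∀ (i : Fin k) → incid (m ↑ʳ i) ≡ (L i , L i , leg (toℕ i))
    incid-loop i rewrite FinP.splitAt-↑ʳ m k i = refl

    module Concat (ps : Vec ℕ (suc m)) (ms : Vec ℕ m) (ls : Vec ℕ k) where
      w : Vec ℕ NE
      w = ps ++ (ms ++ ls)

      w-P : ∀ j → lookup w (P j) ≡ lookup ps j
      w-P j = VP.lookup-++ˡ ps (ms ++ ls) j

      w-M : ∀ j → lookup w (M j) ≡ lookup ms j
      w-M j = trans (VP.lookup-++ʳ ps (ms ++ ls) (j ↑ˡ k)) (VP.lookup-++ˡ ms ls j)

      w-L : ∀ i → lookup w (L i) ≡ lookup ls i
      w-L i = trans (VP.lookup-++ʳ ps (ms ++ ls) (m ↑ʳ i)) (VP.lookup-++ʳ ms ls i)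

      w-leg : ∀ l → lookup w (leg l) ≡ legValue l ps ms
      w-leg zero = trans (w-P zero) (helper ps ms)
        where
        helper : ∀ {n} (ps : Vec ℕ (suc n)) (ms : Vec ℕ n) → lookup ps zero ≡ legValue zero ps ms
        helper (p ∷ _) _ = refl
      w-leg (suc j) with j <? m
      ... | yes j<m = trans (w-M (fromℕ< j<m)) (sym (legValue-middle m j j<m ps ms))
      ... | no j≮m = trans (w-P (fromℕ m)) (sym (legValue-last m j (ℕP.≮⇒≥ j≮m) ps ms))

    pointOK : (Fin k → Bool) → ℕ → Vec ℕ m → Vec ℕ m → Vec ℕ k → Bool
    pointOK hb p ps ms ls = even p ∧ (spineOK p ps ms ∧ allFin k (λ i → loopOK (hb i) (lookup ls i) (legValue (toℕ i) (p ∷ ps) ms)))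

    triSubst : ∀ {a b c a' b' c'} → a ≡ a' → b ≡ b' → c ≡ c' → T (nodeOK a b c) → T (nodeOK a' b' c')
    triSubst refl refl refl q = q

    dnSubst : ∀ {a b a' b'} → a ≡ a' → b ≡ b' → T (loopNodeOK a b) → T (loopNodeOK a' b')
    dnSubst refl refl q = q

    evSubst : ∀ {a a'} → a ≡ a' → T (even a) → T (even a')
    evSubst refl q = q

    parSubst : ∀ {b b' a a'} → b ≡ b' → a ≡ a' → T (parityOK b a) → T (parityOK b' a')
    parSubst refl refl q = q

    even-x+x+y : ∀ x y → T (even y) → T (even (x ℕ.+ x ℕ.+ y))
    even-x+x+y x y ey = even-+ (x ℕ.+ x) y (subst (λ z → T (even z)) (double≡+ x) (≡true⇒T (even-double x))) ey

    nodeEq : ∀ (w : Vec ℕ NE) x y z zv → NodeAt (V.map +_ w) t (x , y , z) zv ≡ IntNode (lookup w x) (lookup w y) (lookup w z) zv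
    nodeEq w x y z zv rewrite VP.lookup-map x +_ w | VP.lookup-map y +_ w | VP.lookup-map z +_ w = refl

    leg∉H : (H : Subset NE) → (∀ j → lookup H (P j) ≡ false) → (∀ j → lookup H (M j) ≡ false) → ∀ l → lookup H (leg l) ≡ false
    leg∉H H hP hM zero = hP zero
    leg∉H H hP hM (suc j) with j <? m
    ... | yes j<m = hM (fromℕ< j<m)
    ... | no _ = hP (fromℕ m)

    module Characterisation (H : Subset NE) (hb : Fin k → Bool)
               (hP : ∀ j → lookup H (P j) ≡ false) (hM : ∀ j → lookup H (M j) ≡ false)
               (hL : ∀ i → lookup H (L i) ≡ hb i)
               (incident-node : ∀ e → Σ (Fin (m ℕ.+ k)) λ v → IncidentTo e (incid v)) where
      open Enumeration t graph H incident-node public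

      module _ (p : ℕ) (ps : Vec ℕ m) (ms : Vec ℕ m) (ls : Vec ℕ k) where
        open Concat (p ∷ ps) ms ls

        zv : Vec ℤ (m ℕ.+ k)
        zv = tabulate (λ v → + halfSum w (incid v))

        NodeAt⇒IntNode : ∀ v x y z → incid v ≡ (x , y , z) → NodeAt (V.map +_ w) t (incid v) (lookup zv v) →
                 IntNode (lookup w x) (lookup w y) (lookup w z) (+ halfSum w (x , y , z))
        NodeAt⇒IntNode v x y z eq n = subst (λ A → A) (nodeEq w x y z _)
          (subst (λ tr → NodeAt (V.map +_ w) t tr (+ halfSum w tr)) eq
            (subst (NodeAt (V.map +_ w) t (incid v)) (VP.lookup∘tabulate (λ v → + halfSum w (incid v)) v) n))

        IntNode⇒NodeAt : ∀ v x y z → incid v ≡ (x , y , z) →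
                 IntNode (lookup w x) (lookup w y) (lookup w z) (+ halfSum w (x , y , z)) → NodeAt (V.map +_ w) t (incid v) (lookup zv v)
        IntNode⇒NodeAt v x y z eq n =
            subst (NodeAt (V.map +_ w) t (incid v)) (sym (VP.lookup∘tabulate (λ v → + halfSum w (incid v)) v))
             (subst (λ tr → NodeAt (V.map +_ w) t tr (+ halfSum w tr)) (sym eq)
              (subst (λ A → A) (sym (nodeEq w x y z _)) n))

        ParityAt : Fin NE → Set
        ParityAt e = 2 ℕD.∣ ℤ.∣ lookup (V.map +_ w) e ℤ.- 𝟙 H e ∣

        ParityAt⇒parityOK : ∀ e → ParityAt e → T (parityOK (lookup H e) (lookup w e))
        ParityAt⇒parityOK e d = 2∣⇒parityOK (lookup H e) (lookup w e) (subst (λ z → 2 ℕD.∣ ℤ.∣ z ℤ.- 𝟙ᵇ (lookup H e) ∣) (VP.lookup-map e +_ w) d)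

        parityOK⇒ParityAt : ∀ e → T (parityOK (lookup H e) (lookup w e)) → ParityAt e
        parityOK⇒ParityAt e q = subst (λ z → 2 ℕD.∣ ℤ.∣ z ℤ.- 𝟙ᵇ (lookup H e) ∣) (sym (VP.lookup-map e +_ w)) (parityOK⇒2∣ (lookup H e) (lookup w e) q)

        IsPoint⇒pointOK : IsPoint w → T (pointOK hb p ps ms ls)
        IsPoint⇒pointOK (q , par) = T∧ (evP zero) (T∧ (spineOK-intro m p ps ms (λ j → evP (suc j)) evM nodeC)
                            (allFin-intro k _ (λ i → T∧ (nodeD i) (parL i))))
          where
          evW : ∀ e → lookup H e ≡ false → T (even (lookup w e))
          evW e h = parSubst {a = lookup w e} h refl (ParityAt⇒parityOK e (par e))
          evP : ∀ j → T (even (lookup (p ∷ ps) j))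
          evP j = evSubst (w-P j) (evW (P j) (hP j))
          evM : ∀ j → T (even (lookup ms j))
          evM j = evSubst (w-M j) (evW (M j) (hM j))
          parL : ∀ i → T (parityOK (hb i) (lookup ls i))
          parL i = parSubst (hL i) (w-L i) (ParityAt⇒parityOK (L i) (par (L i)))
          nodeC : ∀ j → T (nodeOK (lookup (p ∷ ps) (inject₁ j)) (lookup (p ∷ ps) (suc j)) (lookup ms j))
          nodeC j = triSubst (w-P (inject₁ j)) (w-P (suc j)) (w-M j)
            (IntNode⇒nodeOK a b c (even-+ (a ℕ.+ b) c (even-+ a b (evW (P (inject₁ j)) (hP (inject₁ j))) (evW (P (suc j)) (hP (suc j)))) (evW (M j) (hM j)))
              (NodeAt⇒IntNode (j ↑ˡ k) (P (inject₁ j)) (P (suc j)) (M j) (incid-spine j) (q (j ↑ˡ k))))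
            where
            a = lookup w (P (inject₁ j))
            b = lookup w (P (suc j))
            c = lookup w (M j)
          nodeD : ∀ i → T (loopNodeOK (lookup ls i) (legValue (toℕ i) (p ∷ ps) ms))
          nodeD i = dnSubst (w-L i) (w-leg (toℕ i))
            (nodeOK⇒loopNodeOK x y (IntNode⇒nodeOK x x y (even-x+x+y x y (evW (leg (toℕ i)) (leg∉H H hP hM (toℕ i))))
              (NodeAt⇒IntNode (m ↑ʳ i) (L i) (L i) (leg (toℕ i)) (incid-loop i) (q (m ↑ʳ i)))))
            where
            x = lookup w (L i)
            y = lookup w (leg (toℕ i))

        pointOK⇒IsPoint : T (pointOK hb p ps ms ls) → IsPoint w
        pointOK⇒IsPoint g = inq , par
          where
          c1 = even p
          c2 = spineOK p ps ms
          c3 = allFin k (λ i → loopOK (hb i) (lookup ls i) (legValue (toℕ i) (p ∷ ps) ms))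
          g1 = T∧₁ c1 (c2 ∧ c3) g
          g23 = T∧₂ c1 (c2 ∧ c3) g
          g2 = T∧₁ c2 c3 g23
          g3 = T∧₂ c2 c3 g23
          ce = spineOK-elim m p ps ms g2
          evP : ∀ j → T (even (lookup (p ∷ ps) j))
          evP zero = g1
          evP (suc j) = proj₁ ce j
          evM = proj₁ (proj₂ ce)
          trC = proj₂ (proj₂ ce)
          lp : ∀ i → T (loopOK (hb i) (lookup ls i) (legValue (toℕ i) (p ∷ ps) ms))
          lp = allFin-elim k _ g3
          dnL : ∀ i → T (loopNodeOK (lookup ls i) (legValue (toℕ i) (p ∷ ps) ms))
          dnL i = T∧₁ (loopNodeOK (lookup ls i) (legValue (toℕ i) (p ∷ ps) ms)) (parityOK (hb i) (lookup ls i)) (lp i)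
          parL : ∀ i → T (parityOK (hb i) (lookup ls i))
          parL i = T∧₂ (loopNodeOK (lookup ls i) (legValue (toℕ i) (p ∷ ps) ms)) (parityOK (hb i) (lookup ls i)) (lp i)
          evW : ∀ e → lookup H e ≡ false → T (even (lookup w e)) → ParityAt e
          evW e h q = parityOK⇒ParityAt e (parSubst {a = lookup w e} (sym h) refl q)
          par : ∀ e → ParityAt e
          par = ∀-↑ˡ-↑ʳ (suc m) (m ℕ.+ k) {ParityAt}
            (λ j → evW (P j) (hP j) (evSubst (sym (w-P j)) (evP j)))
            (∀-↑ˡ-↑ʳ m k {λ r → ParityAt (suc m ↑ʳ r)} (λ j → evW (M j) (hM j) (evSubst (sym (w-M j)) (evM j)))
                         (λ i → parityOK⇒ParityAt (L i) (parSubst (sym (hL i)) (sym (w-L i)) (parL i))))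
          evw : ∀ e → lookup H e ≡ false → T (even (lookup w e))
          evw e h = parSubst {a = lookup w e} h refl (ParityAt⇒parityOK e (par e))
          inq : InTQ t graph (V.map +_ w) zv
          inq = ∀-↑ˡ-↑ʳ m k {λ v → NodeAt (V.map +_ w) t (incid v) (lookup zv v)}
            (λ j → IntNode⇒NodeAt (j ↑ˡ k) (P (inject₁ j)) (P (suc j)) (M j) (incid-spine j)
               (nodeOK⇒IntNode (a j) (b j) (c j) (even-+ (a j ℕ.+ b j) (c j) (even-+ (a j) (b j) (evw (P (inject₁ j)) (hP (inject₁ j))) (evw (P (suc j)) (hP (suc j)))) (evw (M j) (hM j)))
                 (triSubst (sym (w-P (inject₁ j))) (sym (w-P (suc j))) (sym (w-M j)) (trC j))))
            (λ i → IntNode⇒NodeAt (m ↑ʳ i) (L i) (L i) (leg (toℕ i)) (incid-loop i)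
               (nodeOK⇒IntNode (x i) (x i) (y i) (even-x+x+y (x i) (y i) (evw (leg (toℕ i)) (leg∉H H hP hM (toℕ i))))
                 (loopNodeOK⇒nodeOK (x i) (y i) (dnSubst (sym (w-L i)) (sym (w-leg (toℕ i))) (dnL i)))))
            where
            a = λ j → lookup w (P (inject₁ j))
            b = λ j → lookup w (P (suc j))
            c = λ j → lookup w (M j)
            x = λ i → lookup w (L i)
            y = λ i → lookup w (leg (toℕ i))

        indicator-IsPoint : indicator (IsPoint? w) ≡ [ pointOK hb p ps ms ls ]
        indicator-IsPoint = indicator-reflects (IsPoint? w) (pointOK hb p ps ms ls) IsPoint⇒pointOK pointOK⇒IsPoint


module SpineCollapse where

  open Sums
  open Parity
  open CaterpillarPoints
  open import Data.Nat as ℕ using (ℕ; zero; suc; _≤_; z≤n; s≤s)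
  open import Data.Integer using (ℤ; 1ℤ; _*_)
  import Data.Integer.Properties as ℤP
  open import Data.Integer.Tactic.RingSolver
  open import Algebra.Properties.CommutativeSemigroup ℤP.*-commutativeSemigroup using (interchange)
  open import Data.Bool using (Bool; _∧_; if_then_else_)
  open import Data.Vec using (Vec; _∷_)
  open import Relation.Binary.PropositionalEquality hiding ([_])
  open ≡-Reasoning

  -- On even values the hypothesis Σσ-nodeOK factorises the σ-weighted sum over the third edge
  -- value at a node; summing the spine from one end with weight σ thus peels off one node at a
  -- time, and the whole spine collapses into the product of the σ-weighted leg factors.
  module Collapse (t B : ℕ) (σ : ℕ → ℤ)
     (Σσ-nodeOK : ∀ a b → [ even a ] * [ even b ] * ΣN B (λ x → σ x * [ SpineConditions.nodeOK t x a b ]) ≡ σ a * σ b) where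
    open SpineConditions t
    open BoxSums B

    stepOK : ℕ → ℕ → ℕ → Bool
    stepOK p p' μ = even p' ∧ (even μ ∧ nodeOK p p' μ)

    stepOK-split : ∀ p p' μ → [ stepOK p p' μ ] ≡ [ even p' ] * ([ even μ ] * [ nodeOK p p' μ ])
    stepOK-split p p' μ = trans ([∧] (even p') _) (cong ([ even p' ] *_) ([∧] (even μ) _))

    weighted : (ℕ → ℤ) → ℤ
    weighted g = ΣN B (λ y → σ y * g y)

    -- The spine starting with path value p, leg l ≥ 1 contributing the factor G l.
    spineSum : (ℕ → ℕ → ℤ) → ℕ → ℕ → ℤ
    spineSum G n p = SumV n (λ ps → SumV n (λ ms → [ spineOK p ps ms ] * ΠN (suc n) (λ l → G (suc l) (legValue (suc l) (p ∷ ps) ms))))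

    spineSum-zero : ∀ G p → spineSum G 0 p ≡ G 1 p
    spineSum-zero G p = e (G 1 p)
      where
      e : ∀ x → 1ℤ * (x * 1ℤ) ≡ x
      e = solve-∀

    spineSum-suc : ∀ G n p → spineSum G (suc n) p ≡ ΣN B (λ p' → ΣN B (λ μ → [ stepOK p p' μ ] * (G 1 μ * spineSum (λ l → G (suc l)) n p')))
    spineSum-suc G n p = begin
      ΣN B (λ p' → SumV n (λ ps → ΣN B (λ μ → SumV n (λ ms → [ stepOK p p' μ ∧ spineOK p' ps ms ] * (G 1 μ * Π' p' ps ms)))))
        ≡⟨ ΣN-ext B (λ p' → SumV-ext n (λ ps → ΣN-ext B (λ μ → sum-rest p' ps μ))) ⟩
      ΣN B (λ p' → SumV n (λ ps → ΣN B (λ μ → CK p' μ * In p' ps)))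
        ≡⟨ ΣN-ext B (λ p' → SumV-ΣN n B (λ ps μ → CK p' μ * In p' ps)) ⟩
      ΣN B (λ p' → ΣN B (λ μ → SumV n (λ ps → CK p' μ * In p' ps)))
        ≡⟨ ΣN-ext B (λ p' → ΣN-ext B (λ μ → SumV-*ˡ n (CK p' μ) (In p'))) ⟩
      ΣN B (λ p' → ΣN B (λ μ → CK p' μ * spineSum (λ l → G (suc l)) n p'))
        ≡⟨ ΣN-ext B (λ p' → ΣN-ext B (λ μ → ℤP.*-assoc [ stepOK p p' μ ] (G 1 μ) (spineSum (λ l → G (suc l)) n p'))) ⟩
      ΣN B (λ p' → ΣN B (λ μ → [ stepOK p p' μ ] * (G 1 μ * spineSum (λ l → G (suc l)) n p'))) ∎
      where
      Π' : ℕ → Vec ℕ n → Vec ℕ n → ℤ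
      Π' p' ps ms = ΠN (suc n) (λ l → G (suc (suc l)) (legValue (suc l) (p' ∷ ps) ms))
      CK : ℕ → ℕ → ℤ
      CK p' μ = [ stepOK p p' μ ] * G 1 μ
      In : ℕ → Vec ℕ n → ℤ
      In p' ps = SumV n (λ ms → [ spineOK p' ps ms ] * Π' p' ps ms)
      sum-rest : ∀ p' ps μ → SumV n (λ ms → [ stepOK p p' μ ∧ spineOK p' ps ms ] * (G 1 μ * Π' p' ps ms))
                        ≡ CK p' μ * In p' ps
      sum-rest p' ps μ = trans (SumV-ext n (λ ms → trans (cong (_* (G 1 μ * Π' p' ps ms)) ([∧] (stepOK p p' μ) (spineOK p' ps ms)))
                                                     (interchange [ stepOK p p' μ ] [ spineOK p' ps ms ] (G 1 μ) (Π' p' ps ms))))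
                            (SumV-*ˡ n (CK p' μ) (λ ms → [ spineOK p' ps ms ] * Π' p' ps ms))

    spineSum-collapse : ∀ n G → ΣN B (λ p → σ p * spineSum G n p) ≡ ΠN (suc n) (λ j → weighted (G (suc j)))
    spineSum-collapse zero G = trans (ΣN-ext B (λ p → cong (σ p *_) (spineSum-zero G p))) (sym (ℤP.*-identityʳ (weighted (G 1))))
    spineSum-collapse (suc n) G = begin
      ΣN B (λ p → σ p * spineSum G (suc n) p)
        ≡⟨ ΣN-ext B (λ p → cong (σ p *_) (spineSum-suc G n p)) ⟩
      ΣN B (λ p → σ p * ΣN B (λ p' → ΣN B (λ μ → [ stepOK p p' μ ] * R p' μ)))
        ≡⟨ ΣN-ext B (λ p → ΣΣ-*ˡ B (σ p) (λ p' μ → [ stepOK p p' μ ] * R p' μ)) ⟩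
      ΣN B (λ p → ΣN B (λ p' → ΣN B (λ μ → σ p * ([ stepOK p p' μ ] * R p' μ))))
        ≡⟨ ΣN-swap B B (λ p p' → ΣN B (λ μ → σ p * ([ stepOK p p' μ ] * R p' μ))) ⟩
      ΣN B (λ p' → ΣN B (λ p → ΣN B (λ μ → σ p * ([ stepOK p p' μ ] * R p' μ))))
        ≡⟨ ΣN-ext B (λ p' → ΣN-swap B B (λ p μ → σ p * ([ stepOK p p' μ ] * R p' μ))) ⟩
      ΣN B (λ p' → ΣN B (λ μ → ΣN B (λ p → σ p * ([ stepOK p p' μ ] * R p' μ))))
        ≡⟨ ΣN-ext B (λ p' → ΣN-ext B (λ μ → sum-first p' μ)) ⟩
      ΣN B (λ p' → ΣN B (λ μ → (σ p' * σ μ) * R p' μ))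
        ≡⟨ ΣN-ext B (λ p' → trans (ΣN-ext B (λ μ → ρ3 (σ p') (σ μ) (G 1 μ) (L' p'))) (ΣN-*ˡ B (σ p' * L' p') (λ μ → σ μ * G 1 μ))) ⟩
      ΣN B (λ p' → (σ p' * L' p') * weighted (G 1))
        ≡⟨ ΣN-*ʳ B (weighted (G 1)) (λ p' → σ p' * L' p') ⟩
      ΣN B (λ p' → σ p' * L' p') * weighted (G 1)
        ≡⟨ cong (_* weighted (G 1)) (spineSum-collapse n (λ l → G (suc l))) ⟩
      ΠN (suc n) (λ j → weighted (G (suc (suc j)))) * weighted (G 1)
        ≡⟨ ℤP.*-comm (ΠN (suc n) (λ j → weighted (G (suc (suc j))))) (weighted (G 1)) ⟩
      ΠN (suc (suc n)) (λ j → weighted (G (suc j))) ∎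
      where
      L' : ℕ → ℤ
      L' p' = spineSum (λ l → G (suc l)) n p'
      R : ℕ → ℕ → ℤ
      R p' μ = G 1 μ * L' p'
      ρ1 : ∀ s e1 e2 tr r → s * (e1 * (e2 * tr) * r) ≡ (s * tr) * (e1 * e2 * r)
      ρ1 = solve-∀
      ρ3 : ∀ a b g l → (a * b) * (g * l) ≡ (a * l) * (b * g)
      ρ3 = solve-∀
      ρ4 : ∀ s a b r → s * (a * b * r) ≡ (a * b * s) * r
      ρ4 = solve-∀
      sum-first : ∀ p' μ → ΣN B (λ p → σ p * ([ stepOK p p' μ ] * R p' μ)) ≡ (σ p' * σ μ) * R p' μ
      sum-first p' μ = begin
        ΣN B (λ p → σ p * ([ stepOK p p' μ ] * R p' μ))
          ≡⟨ ΣN-ext B (λ p → trans (cong (λ z → σ p * (z * R p' μ)) (stepOK-split p p' μ))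
                                   (ρ1 (σ p) [ even p' ] [ even μ ] [ nodeOK p p' μ ] (R p' μ))) ⟩
        ΣN B (λ p → (σ p * [ nodeOK p p' μ ]) * ([ even p' ] * [ even μ ] * R p' μ))
          ≡⟨ ΣN-*ʳ B ([ even p' ] * [ even μ ] * R p' μ) (λ p → σ p * [ nodeOK p p' μ ]) ⟩
        ΣN B (λ p → σ p * [ nodeOK p p' μ ]) * ([ even p' ] * [ even μ ] * R p' μ)
          ≡⟨ ρ4 (ΣN B (λ p → σ p * [ nodeOK p p' μ ])) [ even p' ] [ even μ ] (R p' μ) ⟩
        ([ even p' ] * [ even μ ] * ΣN B (λ p → σ p * [ nodeOK p p' μ ])) * R p' μ
          ≡⟨ cong (_* R p' μ) (Σσ-nodeOK p' μ) ⟩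
        (σ p' * σ μ) * R p' μ ∎

    spineSum-marked-first : ∀ n G → (∀ y → [ even y ] * G 1 y ≡ σ y) →
      ∀ p → [ even p ] * spineSum G (suc n) p ≡ σ p * ΠN (suc n) (λ j → weighted (G (suc (suc j))))
    spineSum-marked-first n G hyp p = begin
      [ even p ] * spineSum G (suc n) p
        ≡⟨ cong ([ even p ] *_) (spineSum-suc G n p) ⟩
      [ even p ] * ΣN B (λ p' → ΣN B (λ μ → [ stepOK p p' μ ] * (G 1 μ * L' p')))
        ≡⟨ ΣΣ-*ˡ B [ even p ] (λ p' μ → [ stepOK p p' μ ] * (G 1 μ * L' p')) ⟩
      ΣN B (λ p' → ΣN B (λ μ → [ even p ] * ([ stepOK p p' μ ] * (G 1 μ * L' p'))))
        ≡⟨ ΣN-ext B (λ p' → ΣN-ext B (λ μ → regroup p' μ)) ⟩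
      ΣN B (λ p' → ΣN B (λ μ → ([ even p ] * [ even p' ] * L' p') * (σ μ * [ nodeOK μ p p' ])))
        ≡⟨ ΣN-ext B (λ p' → ΣN-*ˡ B ([ even p ] * [ even p' ] * L' p') (λ μ → σ μ * [ nodeOK μ p p' ])) ⟩
      ΣN B (λ p' → ([ even p ] * [ even p' ] * L' p') * ΣN B (λ μ → σ μ * [ nodeOK μ p p' ]))
        ≡⟨ ΣN-ext B (λ p' → trans (ρ5 [ even p ] [ even p' ] (L' p') (ΣN B (λ μ → σ μ * [ nodeOK μ p p' ])))
                                   (cong (_* L' p') (Σσ-nodeOK p p'))) ⟩
      ΣN B (λ p' → (σ p * σ p') * L' p')
        ≡⟨ ΣN-ext B (λ p' → ℤP.*-assoc (σ p) (σ p') (L' p')) ⟩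
      ΣN B (λ p' → σ p * (σ p' * L' p'))
        ≡⟨ ΣN-*ˡ B (σ p) (λ p' → σ p' * L' p') ⟩
      σ p * ΣN B (λ p' → σ p' * L' p')
        ≡⟨ cong (σ p *_) (spineSum-collapse n (λ l → G (suc l))) ⟩
      σ p * ΠN (suc n) (λ j → weighted (G (suc (suc j)))) ∎
      where
      L' : ℕ → ℤ
      L' p' = spineSum (λ l → G (suc l)) n p'
      ρ0 : ∀ e e' em tr g l → e * ((e' * (em * tr)) * (g * l)) ≡ (e * e' * l) * ((em * g) * tr)
      ρ0 = solve-∀
      ρ5 : ∀ a b l x → (a * b * l) * x ≡ (a * b * x) * l
      ρ5 = solve-∀
      regroup : ∀ p' μ → [ even p ] * ([ stepOK p p' μ ] * (G 1 μ * L' p')) ≡ ([ even p ] * [ even p' ] * L' p') * (σ μ * [ nodeOK μ p p' ])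
      regroup p' μ = begin
        [ even p ] * ([ stepOK p p' μ ] * (G 1 μ * L' p'))
          ≡⟨ cong (λ z → [ even p ] * (z * (G 1 μ * L' p'))) (stepOK-split p p' μ) ⟩
        [ even p ] * (([ even p' ] * ([ even μ ] * [ nodeOK p p' μ ])) * (G 1 μ * L' p'))
          ≡⟨ ρ0 [ even p ] [ even p' ] [ even μ ] [ nodeOK p p' μ ] (G 1 μ) (L' p') ⟩
        ([ even p ] * [ even p' ] * L' p') * (([ even μ ] * G 1 μ) * [ nodeOK p p' μ ])
          ≡⟨ cong₂ (λ a b → ([ even p ] * [ even p' ] * L' p') * (a * [ b ])) (hyp μ) (nodeOK-rotate p p' μ) ⟩
        ([ even p ] * [ even p' ] * L' p') * (σ μ * [ nodeOK μ p p' ]) ∎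

    spineSum-marked-later : ∀ n G (Π' : ℤ) → (∀ p' → [ even p' ] * spineSum (λ l → G (suc l)) n p' ≡ σ p' * Π') →
      ∀ p → [ even p ] * spineSum G (suc n) p ≡ σ p * (weighted (G 1) * Π')
    spineSum-marked-later n G Π' IH p = begin
      [ even p ] * spineSum G (suc n) p
        ≡⟨ cong ([ even p ] *_) (spineSum-suc G n p) ⟩
      [ even p ] * ΣN B (λ p' → ΣN B (λ μ → [ stepOK p p' μ ] * (G 1 μ * L' p')))
        ≡⟨ ΣΣ-*ˡ B [ even p ] (λ p' μ → [ stepOK p p' μ ] * (G 1 μ * L' p')) ⟩
      ΣN B (λ p' → ΣN B (λ μ → [ even p ] * ([ stepOK p p' μ ] * (G 1 μ * L' p'))))
        ≡⟨ ΣN-swap B B (λ p' μ → [ even p ] * ([ stepOK p p' μ ] * (G 1 μ * L' p'))) ⟩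
      ΣN B (λ μ → ΣN B (λ p' → [ even p ] * ([ stepOK p p' μ ] * (G 1 μ * L' p'))))
        ≡⟨ ΣN-ext B (λ μ → ΣN-ext B (λ p' → regroup p' μ)) ⟩
      ΣN B (λ μ → ΣN B (λ p' → (G 1 μ * [ even p ] * [ even μ ] * Π') * (σ p' * [ nodeOK p' p μ ])))
        ≡⟨ ΣN-ext B (λ μ → ΣN-*ˡ B (G 1 μ * [ even p ] * [ even μ ] * Π') (λ p' → σ p' * [ nodeOK p' p μ ])) ⟩
      ΣN B (λ μ → (G 1 μ * [ even p ] * [ even μ ] * Π') * ΣN B (λ p' → σ p' * [ nodeOK p' p μ ]))
        ≡⟨ ΣN-ext B (λ μ → trans (ρ6 (G 1 μ) [ even p ] [ even μ ] Π' (ΣN B (λ p' → σ p' * [ nodeOK p' p μ ])))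
                                  (cong (λ z → (G 1 μ * Π') * z) (Σσ-nodeOK p μ))) ⟩
      ΣN B (λ μ → (G 1 μ * Π') * (σ p * σ μ))
        ≡⟨ ΣN-ext B (λ μ → ρ7 (G 1 μ) Π' (σ p) (σ μ)) ⟩
      ΣN B (λ μ → (σ p * Π') * (σ μ * G 1 μ))
        ≡⟨ ΣN-*ˡ B (σ p * Π') (λ μ → σ μ * G 1 μ) ⟩
      (σ p * Π') * weighted (G 1)
        ≡⟨ ρ8 (σ p) Π' (weighted (G 1)) ⟩
      σ p * (weighted (G 1) * Π') ∎
      where
      L' : ℕ → ℤ
      L' p' = spineSum (λ l → G (suc l)) n p'
      ρ0 : ∀ e e' em tr g l → e * ((e' * (em * tr)) * (g * l)) ≡ (g * e * em) * (tr * (e' * l))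
      ρ0 = solve-∀
      ρ1 : ∀ g e em π sg tr → (g * e * em) * (tr * (sg * π)) ≡ (g * e * em * π) * (sg * tr)
      ρ1 = solve-∀
      ρ6 : ∀ g e em π x → (g * e * em * π) * x ≡ (g * π) * (e * em * x)
      ρ6 = solve-∀
      ρ7 : ∀ g π a b → (g * π) * (a * b) ≡ (a * π) * (b * g)
      ρ7 = solve-∀
      ρ8 : ∀ a π c → (a * π) * c ≡ a * (c * π)
      ρ8 = solve-∀
      regroup : ∀ p' μ → [ even p ] * ([ stepOK p p' μ ] * (G 1 μ * L' p')) ≡ (G 1 μ * [ even p ] * [ even μ ] * Π') * (σ p' * [ nodeOK p' p μ ])
      regroup p' μ = begin
        [ even p ] * ([ stepOK p p' μ ] * (G 1 μ * L' p'))
          ≡⟨ cong (λ z → [ even p ] * (z * (G 1 μ * L' p'))) (stepOK-split p p' μ) ⟩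
        [ even p ] * (([ even p' ] * ([ even μ ] * [ nodeOK p p' μ ])) * (G 1 μ * L' p'))
          ≡⟨ ρ0 [ even p ] [ even p' ] [ even μ ] [ nodeOK p p' μ ] (G 1 μ) (L' p') ⟩
        (G 1 μ * [ even p ] * [ even μ ]) * ([ nodeOK p p' μ ] * ([ even p' ] * L' p'))
          ≡⟨ cong₂ (λ a b → (G 1 μ * [ even p ] * [ even μ ]) * ([ a ] * b)) (nodeOK-swap p p' μ) (IH p') ⟩
        (G 1 μ * [ even p ] * [ even μ ]) * ([ nodeOK p' p μ ] * (σ p' * Π'))
          ≡⟨ ρ1 (G 1 μ) [ even p ] [ even μ ] Π' (σ p') [ nodeOK p' p μ ] ⟩
        (G 1 μ * [ even p ] * [ even μ ] * Π') * (σ p' * [ nodeOK p' p μ ]) ∎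

    -- The marked leg, whose factor is σ on even values, plays the role of the σ-weighted end of
    -- the spine and so contributes the factor 1.
    spineSum-collapse-marked : ∀ n G s → s ≤ n → (∀ y → [ even y ] * G (suc s) y ≡ σ y) →
      ∀ p → [ even p ] * spineSum G n p ≡ σ p * ΠN (suc n) (λ j → if j ℕ.≡ᵇ s then 1ℤ else weighted (G (suc j)))
    spineSum-collapse-marked zero G zero z≤n hyp p = trans (cong ([ even p ] *_) (spineSum-zero G p)) (trans (hyp p) (sym (ℤP.*-identityʳ (σ p))))
    spineSum-collapse-marked (suc n) G zero z≤n hyp p =
      trans (spineSum-marked-first n G hyp p) (cong (σ p *_) (sym (ℤP.*-identityˡ _)))
    spineSum-collapse-marked (suc n) G (suc s) (s≤s le) hyp p =
      spineSum-marked-later n G _ (spineSum-collapse-marked n (λ l → G (suc l)) s le hyp) p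

module AlternatingSums where

  open Sums
  open Parity
  open import Data.Nat as ℕ using (ℕ; zero; suc; _≤_; _<_; s≤s; _≤ᵇ_)
  import Data.Nat.Properties as ℕP
  import Data.Nat.Tactic.RingSolver as NS
  open import Data.Integer using (ℤ; +_; 0ℤ; 1ℤ; _+_; _*_; -_; _-_)
  import Data.Integer.Properties as ℤP
  open import Data.Integer.Tactic.RingSolver
  open import Data.Bool using (Bool; true; false; not; _∧_; T)
  open import Data.Bool.Properties using (∧-zeroʳ)
  open import Data.Unit using (tt)
  open import Data.Empty using (⊥-elim)
  open import Data.Product using (_,_; _×_)
  open import Relation.Nullary using (yes; no)
  open import Data.Sum using (inj₁; inj₂)
  open import Relation.Binary.PropositionalEquality hiding ([_])
  open ≡-Reasoning

  sign : ℕ → ℤ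
  sign zero = 1ℤ
  sign (suc zero) = - 1ℤ
  sign (suc (suc n)) = sign n

  sign-suc : ∀ b → sign (suc b) ≡ - sign b
  sign-suc zero = refl
  sign-suc (suc zero) = refl
  sign-suc (suc (suc b)) = sign-suc b

  sign-+ : ∀ a b → sign (a ℕ.+ b) ≡ sign a * sign b
  sign-+ zero b = sym (ℤP.*-identityˡ (sign b))
  sign-+ (suc zero) b = trans (sign-suc b) (sym (ℤP.-1*i≡-i (sign b)))
  sign-+ (suc (suc a)) b = sign-+ a b

  sign-double : ∀ a → sign (double a) ≡ 1ℤ
  sign-double zero = refl
  sign-double (suc a) = sign-double a

  even+sign : ∀ d → [ even d ] + sign (suc d) ≡ [ even (suc d) ]
  even+sign zero = refl
  even+sign (suc zero) = refl
  even+sign (suc (suc d)) = even+sign d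

  Σ-sign≡even : ∀ d → ΣN (suc d) sign ≡ [ even d ]
  Σ-sign≡even zero = refl
  Σ-sign≡even (suc d) = trans (ΣN-snoc (suc d) sign) (trans (cong (_+ sign (suc d)) (Σ-sign≡even d)) (even+sign d))

  even-odd≡sign : ∀ x → [ even x ] - [ not (even x) ] ≡ sign x
  even-odd≡sign zero = refl
  even-odd≡sign (suc zero) = refl
  even-odd≡sign (suc (suc x)) = even-odd≡sign x

  ≤ᵇ-false : ∀ m n → n < m → (m ≤ᵇ n) ≡ false
  ≤ᵇ-false m n lt with m ≤ᵇ n in eq
  ... | true = ⊥-elim (ℕP.<⇒≱ lt (≤ᵇ⇒≤ (subst T (sym eq) tt)))
  ... | false = refl

  ≤ᵇ-true : ∀ m n → m ≤ n → (m ≤ᵇ n) ≡ true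
  ≤ᵇ-true m n le = T⇒≡true (ℕP.≤⇒≤ᵇ le)

  Σ-sign-interval : ∀ N lo d (P : ℕ → Bool) → lo ℕ.+ d < N → (∀ x → x < N → P x ≡ ((lo ≤ᵇ x) ∧ (x ≤ᵇ lo ℕ.+ d))) →
       ΣN N (λ x → sign x * [ P x ]) ≡ [ even d ] * sign lo
  Σ-sign-interval N lo d P lt hP with ℕP.m≤n⇒∃[o]m+o≡n lt
  ... | r , refl = begin
    ΣN (suc (lo ℕ.+ d) ℕ.+ r) (λ x → sign x * [ P x ])
      ≡⟨ ΣN-cong (suc (lo ℕ.+ d) ℕ.+ r) (λ x x< → cong (λ b → sign x * [ b ]) (hP x x<)) ⟩
    ΣN (suc (lo ℕ.+ d) ℕ.+ r) f
      ≡⟨ ΣN-window lo d r f below above ⟩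
    ΣN (suc d) (λ x → f (lo ℕ.+ x))
      ≡⟨ ΣN-cong (suc d) inside ⟩
    ΣN (suc d) (λ x → sign lo * sign x)
      ≡⟨ ΣN-*ˡ (suc d) (sign lo) sign ⟩
    sign lo * ΣN (suc d) sign
      ≡⟨ cong (sign lo *_) (Σ-sign≡even d) ⟩
    sign lo * [ even d ]
      ≡⟨ ℤP.*-comm (sign lo) [ even d ] ⟩
    [ even d ] * sign lo ∎
    where
    f : ℕ → ℤ
    f x = sign x * [ (lo ≤ᵇ x) ∧ (x ≤ᵇ lo ℕ.+ d) ]
    below : ∀ x → x < lo → f x ≡ 0ℤ
    below x x<lo = trans (cong (λ b → sign x * [ b ∧ (x ≤ᵇ lo ℕ.+ d) ]) (≤ᵇ-false lo x x<lo)) (ℤP.*-zeroʳ (sign x))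
    above : ∀ x → lo ℕ.+ d < x → f x ≡ 0ℤ
    above x lt = trans (cong (λ b → sign x * [ (lo ≤ᵇ x) ∧ b ]) (≤ᵇ-false _ _ lt))
                       (trans (cong (λ b → sign x * [ b ]) (∧-zeroʳ (lo ≤ᵇ x))) (ℤP.*-zeroʳ (sign x)))
    inside : ∀ x → x < suc d → f (lo ℕ.+ x) ≡ sign lo * sign x
    inside x (s≤s x≤d) = trans (cong₂ (λ a b → sign (lo ℕ.+ x) * [ a ∧ b ]) (≤ᵇ-true _ _ (ℕP.m≤m+n lo x))
                                 (≤ᵇ-true _ _ (ℕP.+-monoʳ-≤ lo x≤d)))
                           (trans (ℤP.*-identityʳ _) (sign-+ lo x))

  Σ-sign-empty : ∀ N (P : ℕ → Bool) → (∀ x → x < N → P x ≡ false) → ΣN N (λ x → sign x * [ P x ]) ≡ 0ℤ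
  Σ-sign-empty N P h = ΣN-zero N _ (λ x x< → trans (cong (λ b → sign x * [ b ]) (h x x<)) (ℤP.*-zeroʳ (sign x)))

  Σ-even : ∀ T (g : ℕ → ℤ) → ΣN (suc (double T)) (λ y → [ even y ] * g y) ≡ ΣN (suc T) (λ u → g (double u))
  Σ-even zero g = cong (_+ 0ℤ) (ℤP.*-identityˡ (g 0))
  Σ-even (suc T) g = begin
    [ true ] * g 0 + ([ false ] * g 1 + ΣN (suc (double T)) (λ y → [ even y ] * g (suc (suc y))))
      ≡⟨ cong₂ _+_ (ℤP.*-identityˡ (g 0)) (trans (cong (_+ ΣN (suc (double T)) (λ y → [ even y ] * g (suc (suc y)))) (ℤP.*-zeroˡ (g 1))) (ℤP.+-identityˡ _)) ⟩
    g 0 + ΣN (suc (double T)) (λ y → [ even y ] * g (suc (suc y)))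
      ≡⟨ cong (_+_ (g 0)) (Σ-even T (λ y → g (suc (suc y)))) ⟩
    g 0 + ΣN (suc T) (λ u → g (double (suc u))) ∎

  even-n+n : ∀ e → even (e ℕ.+ e) ≡ true
  even-n+n e = trans (cong even (sym (double≡+ e))) (even-double e)

  module Halved (τ : ℕ) where
    open NodeConditions τ using (nodeOK; nodeOK-elim; nodeOK-intro; nodeOK-rotate; nodeOK-swap)

    truncSign : ℕ → ℤ
    truncSign u = [ u ≤ᵇ τ ] * sign u

    ≤ᵇ∧≤ᵇ-intro : ∀ {a b} → (a ≤ b) → ∀ {c d} → c ≤ d → T ((a ≤ᵇ b) ∧ (c ≤ᵇ d))
    ≤ᵇ∧≤ᵇ-intro p q = T∧ (ℕP.≤⇒≤ᵇ p) (ℕP.≤⇒≤ᵇ q)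

    ≤ᵇ∧≤ᵇ-elim : ∀ a b c d → T ((a ≤ᵇ b) ∧ (c ≤ᵇ d)) → (a ≤ b) × (c ≤ d)
    ≤ᵇ∧≤ᵇ-elim a b c d q = ≤ᵇ⇒≤ (T∧₁ (a ≤ᵇ b) (c ≤ᵇ d) q) , ≤ᵇ⇒≤ (T∧₂ (a ≤ᵇ b) (c ≤ᵇ d) q)

    α+d≤u+α⇒d≤u : ∀ u α d → α ℕ.+ d ≤ u ℕ.+ α → d ≤ u
    α+d≤u+α⇒d≤u u α d p = ℕP.+-cancelˡ-≤ α d u (subst (α ℕ.+ d ≤_) (ℕP.+-comm u α) p)

    nodeOK-empty : ∀ α d → τ < α ℕ.+ d → ∀ u → nodeOK u α (α ℕ.+ d) ≡ false
    nodeOK-empty α d lt u = T-⇔⇒≡ {b = false} f (λ ())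
      where
      f : T (nodeOK u α (α ℕ.+ d)) → T false
      f q with nodeOK-elim u α (α ℕ.+ d) q
      ... | h0 , h1 , h2 , h3 = ℕP.<⇒≱ lt (m+m≤n+n⇒m≤n (α ℕ.+ d) τ chain)
        where
        e1 : ∀ α d → α ℕ.+ d ℕ.+ (α ℕ.+ d) ≡ d ℕ.+ (α ℕ.+ (α ℕ.+ d))
        e1 = NS.solve-∀
        chain : α ℕ.+ d ℕ.+ (α ℕ.+ d) ≤ τ ℕ.+ τ
        chain = ℕP.≤-trans (ℕP.≤-reflexive (e1 α d)) (ℕP.≤-trans (ℕP.+-monoˡ-≤ (α ℕ.+ (α ℕ.+ d)) (α+d≤u+α⇒d≤u u α d h2))
                  (ℕP.≤-trans (ℕP.≤-reflexive (sym (ℕP.+-assoc u α (α ℕ.+ d)))) h3))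


    α+[α+d]≡d+[α+α] : ∀ α d → α ℕ.+ (α ℕ.+ d) ≡ d ℕ.+ (α ℕ.+ α)
    α+[α+d]≡d+[α+α] = NS.solve-∀

    α≤u+[α+d] : ∀ u α d → α ≤ u ℕ.+ (α ℕ.+ d)
    α≤u+[α+d] u α d = ℕP.≤-trans (ℕP.m≤m+n α d) (ℕP.m≤n+m (α ℕ.+ d) u)

    d≤u⇒α+d≤u+α : ∀ u α d → d ≤ u → α ℕ.+ d ≤ u ℕ.+ α
    d≤u⇒α+d≤u+α u α d p = subst (α ℕ.+ d ≤_) (ℕP.+-comm α u) (ℕP.+-monoʳ-≤ α p)

    nodeOK-interval₁ : ∀ α d e → τ ≡ α ℕ.+ d ℕ.+ e → α ≤ e → ∀ u → nodeOK u α (α ℕ.+ d) ≡ ((d ≤ᵇ u) ∧ (u ≤ᵇ d ℕ.+ (α ℕ.+ α)))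
    nodeOK-interval₁ α d e eq le u = T-⇔⇒≡ f g
      where
      f : T (nodeOK u α (α ℕ.+ d)) → T ((d ≤ᵇ u) ∧ (u ≤ᵇ d ℕ.+ (α ℕ.+ α)))
      f q with nodeOK-elim u α (α ℕ.+ d) q
      ... | h0 , h1 , h2 , h3 = ≤ᵇ∧≤ᵇ-intro (α+d≤u+α⇒d≤u u α d h2) (subst (u ≤_) (α+[α+d]≡d+[α+α] α d) h0)
      eqB : ∀ α d → d ℕ.+ (α ℕ.+ α) ℕ.+ α ℕ.+ (α ℕ.+ d) ≡ (α ℕ.+ d ℕ.+ α) ℕ.+ (α ℕ.+ d ℕ.+ α)
      eqB = NS.solve-∀
      g : T ((d ≤ᵇ u) ∧ (u ≤ᵇ d ℕ.+ (α ℕ.+ α))) → T (nodeOK u α (α ℕ.+ d))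
      g q with ≤ᵇ∧≤ᵇ-elim d u u (d ℕ.+ (α ℕ.+ α)) q
      ... | p1 , p2 = nodeOK-intro u α (α ℕ.+ d) (subst (u ≤_) (sym (α+[α+d]≡d+[α+α] α d)) p2 , α≤u+[α+d] u α d , d≤u⇒α+d≤u+α u α d p1 , h3)
        where
        h3 : u ℕ.+ α ℕ.+ (α ℕ.+ d) ≤ τ ℕ.+ τ
        h3 = ℕP.≤-trans (ℕP.+-monoˡ-≤ (α ℕ.+ d) (ℕP.+-monoˡ-≤ α p2))
               (ℕP.≤-trans (ℕP.≤-reflexive (eqB α d))
                 (ℕP.≤-trans (ℕP.+-mono-≤ (ℕP.+-monoʳ-≤ (α ℕ.+ d) le) (ℕP.+-monoʳ-≤ (α ℕ.+ d) le))
                   (ℕP.≤-reflexive (sym (cong₂ ℕ._+_ eq eq)))))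

    nodeOK-interval₂ : ∀ α d e → τ ≡ α ℕ.+ d ℕ.+ e → e ≤ α → ∀ u → nodeOK u α (α ℕ.+ d) ≡ ((d ≤ᵇ u) ∧ (u ≤ᵇ d ℕ.+ (e ℕ.+ e)))
    nodeOK-interval₂ α d e eq le u = T-⇔⇒≡ f g
      where
      eqC : ∀ α d e → α ℕ.+ d ℕ.+ e ℕ.+ (α ℕ.+ d ℕ.+ e) ≡ d ℕ.+ (e ℕ.+ e) ℕ.+ (α ℕ.+ (α ℕ.+ d))
      eqC = NS.solve-∀
      ττ : τ ℕ.+ τ ≡ d ℕ.+ (e ℕ.+ e) ℕ.+ (α ℕ.+ (α ℕ.+ d))
      ττ = trans (cong₂ ℕ._+_ eq eq) (eqC α d e)
      f : T (nodeOK u α (α ℕ.+ d)) → T ((d ≤ᵇ u) ∧ (u ≤ᵇ d ℕ.+ (e ℕ.+ e)))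
      f q with nodeOK-elim u α (α ℕ.+ d) q
      ... | h0 , h1 , h2 , h3 = ≤ᵇ∧≤ᵇ-intro (α+d≤u+α⇒d≤u u α d h2)
              (ℕP.+-cancelʳ-≤ (α ℕ.+ (α ℕ.+ d)) u (d ℕ.+ (e ℕ.+ e))
                (subst₂ _≤_ (ℕP.+-assoc u α (α ℕ.+ d)) ττ h3))
      g : T ((d ≤ᵇ u) ∧ (u ≤ᵇ d ℕ.+ (e ℕ.+ e))) → T (nodeOK u α (α ℕ.+ d))
      g q with ≤ᵇ∧≤ᵇ-elim d u u (d ℕ.+ (e ℕ.+ e)) q
      ... | p1 , p2 = nodeOK-intro u α (α ℕ.+ d)
            (ℕP.≤-trans p2 (ℕP.≤-trans (ℕP.+-monoʳ-≤ d (ℕP.+-mono-≤ le le)) (ℕP.≤-reflexive (sym (α+[α+d]≡d+[α+α] α d)))) ,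
             α≤u+[α+d] u α d , d≤u⇒α+d≤u+α u α d p1 ,
             subst₂ _≤_ (sym (ℕP.+-assoc u α (α ℕ.+ d))) (sym ττ) (ℕP.+-monoˡ-≤ (α ℕ.+ (α ℕ.+ d)) p2))

    sign-α-α+d : ∀ α d → sign α * sign (α ℕ.+ d) ≡ sign d
    sign-α-α+d α d = begin
      sign α * sign (α ℕ.+ d) ≡⟨ sym (sign-+ α (α ℕ.+ d)) ⟩
      sign (α ℕ.+ (α ℕ.+ d)) ≡⟨ cong sign (trans (sym (ℕP.+-assoc α α d)) (cong (ℕ._+ d) (sym (double≡+ α)))) ⟩
      sign (double α ℕ.+ d) ≡⟨ sign-+ (double α) d ⟩
      sign (double α) * sign d ≡⟨ cong (_* sign d) (sign-double α) ⟩
      1ℤ * sign d ≡⟨ ℤP.*-identityˡ (sign d) ⟩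
      sign d ∎
      where open ≡-Reasoning

    -- The u with nodeOK u α (α + d) form an interval starting at d of even length 2α or
    -- 2(τ - α - d), or none at all when α + d > τ; the alternating sum over it is sign d.
    Σ-sign-nodeOK-ordered : ∀ α d → ΣN (suc τ) (λ u → sign u * [ nodeOK u α (α ℕ.+ d) ]) ≡ truncSign α * truncSign (α ℕ.+ d)
    Σ-sign-nodeOK-ordered α d with (α ℕ.+ d) ℕP.≤? τ
    ... | no ¬le = trans (Σ-sign-empty (suc τ) _ (λ x _ → nodeOK-empty α d (ℕP.≰⇒> ¬le) x))
            (sym (trans (cong (truncSign α *_) (trans (cong (λ b → [ b ] * sign (α ℕ.+ d)) (≤ᵇ-false _ _ (ℕP.≰⇒> ¬le))) (ℤP.*-zeroˡ (sign (α ℕ.+ d)))))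
                        (ℤP.*-zeroʳ (truncSign α))))
    ... | yes le with ℕP.m≤n⇒∃[o]m+o≡n le
    ...   | e , eq = trans lhs (sym rhs)
      where
      rhs : truncSign α * truncSign (α ℕ.+ d) ≡ sign d
      rhs = trans (cong₂ _*_ (trans (cong (λ b → [ b ] * sign α) (≤ᵇ-true _ _ (ℕP.≤-trans (ℕP.m≤m+n α d) le))) (ℤP.*-identityˡ _))
                              (trans (cong (λ b → [ b ] * sign (α ℕ.+ d)) (≤ᵇ-true _ _ le)) (ℤP.*-identityˡ _)))
                  (sign-α-α+d α d)
      lhs : ΣN (suc τ) (λ u → sign u * [ nodeOK u α (α ℕ.+ d) ]) ≡ sign d
      lhs with ℕP.≤-total α e
      ... | inj₁ α≤e = trans (Σ-sign-interval (suc τ) d (α ℕ.+ α) _ (s≤s bound) (λ x _ → nodeOK-interval₁ α d e (sym eq) α≤e x))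
                              (trans (cong (λ b → [ b ] * sign d) (even-n+n α)) (ℤP.*-identityˡ (sign d)))
        where
        bound : d ℕ.+ (α ℕ.+ α) ≤ τ
        bound = subst (d ℕ.+ (α ℕ.+ α) ≤_) eq (subst (_≤ α ℕ.+ d ℕ.+ e) (e2 α d) (ℕP.+-monoʳ-≤ (α ℕ.+ d) α≤e))
          where
          e2 : ∀ α d → α ℕ.+ d ℕ.+ α ≡ d ℕ.+ (α ℕ.+ α)
          e2 = NS.solve-∀
      ... | inj₂ e≤α = trans (Σ-sign-interval (suc τ) d (e ℕ.+ e) _ (s≤s bound) (λ x _ → nodeOK-interval₂ α d e (sym eq) e≤α x))
                              (trans (cong (λ b → [ b ] * sign d) (even-n+n e)) (ℤP.*-identityˡ (sign d)))
        where
        bound : d ℕ.+ (e ℕ.+ e) ≤ τ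
        bound = subst (d ℕ.+ (e ℕ.+ e) ≤_) eq (subst₂ _≤_ (e2 d e) (sym (ℕP.+-assoc α d e)) (ℕP.+-monoˡ-≤ (d ℕ.+ e) e≤α))
          where
          e2 : ∀ d e → e ℕ.+ (d ℕ.+ e) ≡ d ℕ.+ (e ℕ.+ e)
          e2 = NS.solve-∀

    nodeOK-swap₂₃ : ∀ u a b → nodeOK u a b ≡ nodeOK u b a
    nodeOK-swap₂₃ u a b = trans (nodeOK-rotate u a b) (nodeOK-swap b u a)

    Σ-sign-nodeOK : ∀ α β → ΣN (suc τ) (λ u → sign u * [ nodeOK u α β ]) ≡ truncSign α * truncSign β
    Σ-sign-nodeOK α β with ℕP.≤-total α β
    ... | inj₁ α≤β with ℕP.m≤n⇒∃[o]m+o≡n α≤β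
    ...   | d , refl = Σ-sign-nodeOK-ordered α d
    Σ-sign-nodeOK α β | inj₂ β≤α with ℕP.m≤n⇒∃[o]m+o≡n β≤α
    ...   | d , refl = trans (ΣN-ext (suc τ) (λ u → cong (λ b → sign u * [ b ]) (nodeOK-swap₂₃ u (β ℕ.+ d) β)))
                         (trans (Σ-sign-nodeOK-ordered β d) (ℤP.*-comm (truncSign β) (truncSign (β ℕ.+ d))))


module LoopWeights where

  open Sums
  open Parity
  open AlternatingSums
  open CaterpillarPoints
  open import Data.Nat as ℕ using (ℕ; suc; _≤_; _<_; s≤s; _≤ᵇ_)
  import Data.Nat.Properties as ℕP
  import Data.Nat.Tactic.RingSolver as NS
  open import Data.Integer using (ℤ; +_; 0ℤ; 1ℤ; _+_; _*_; -_; _-_)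
  import Data.Integer.Properties as ℤP
  open import Data.Integer.Tactic.RingSolver
  open import Algebra.Properties.Ring ℤP.+-*-ring using (x[y-z]≈xy-xz)
  open import Data.Bool using (Bool; true; false; not; _∧_; T)
  open import Data.Unit using (tt)
  open import Data.Product using (_,_; proj₁; proj₂; _×_)
  open import Data.Sum using (inj₁; inj₂; _⊎_)
  open import Relation.Nullary using (yes; no)
  open import Relation.Binary.PropositionalEquality hiding ([_])

  module Weights (τ : ℕ) where
    open Halved τ public
    module Nodes2τ = NodeConditions (double τ)
    module Nodesτ = NodeConditions τ
    open SpineConditions (double τ) using (loopOK)

    B : ℕ
    B = suc (double τ)

    -- σ y = (-1)^(y/2) for even y ≤ 2τ, and 0 otherwise; with this weight the sum over the third
    -- value at a node factorises (Σσ-nodeOK), which is what Collapse needs.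
    σ : ℕ → ℤ
    σ y = [ even y ] * truncSign (half y)

    σ-double : ∀ u → σ (double u) ≡ truncSign u
    σ-double u = trans (cong₂ (λ a b → [ a ] * truncSign b) (even-double u) (half-double u)) (ℤP.*-identityˡ (truncSign u))

    σ-odd : ∀ y → even y ≡ false → σ y ≡ 0ℤ
    σ-odd y e = trans (cong (λ a → [ a ] * truncSign (half y)) e) (ℤP.*-zeroˡ (truncSign (half y)))

    truncSign-≤ : ∀ u → u < suc τ → truncSign u ≡ sign u
    truncSign-≤ u (s≤s le) = trans (cong (λ b → [ b ] * sign u) (≤ᵇ-true u τ le)) (ℤP.*-identityˡ (sign u))

    double≤double+double⇒≤ : ∀ a b c → (double a ≤ double b ℕ.+ double c) → a ≤ b ℕ.+ c
    double≤double+double⇒≤ a b c p = double-cancel-≤ (subst (double a ≤_) (sym (double-+ b c)) p)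

    ≤+⇒double≤double+double : ∀ a b c → a ≤ b ℕ.+ c → double a ≤ double b ℕ.+ double c
    ≤+⇒double≤double+double a b c p = subst (double a ≤_) (double-+ b c) (double-mono-≤ p)

    double-+₃ : ∀ u a b → double u ℕ.+ double a ℕ.+ double b ≡ double (u ℕ.+ a ℕ.+ b)
    double-+₃ u a b = sym (trans (double-+ (u ℕ.+ a) b) (cong (ℕ._+ double b) (double-+ u a)))

    double-τ+τ : double τ ℕ.+ double τ ≡ double (τ ℕ.+ τ)
    double-τ+τ = sym (double-+ τ τ)

    nodeOK-double : ∀ u a b → Nodes2τ.nodeOK (double u) (double a) (double b) ≡ Nodesτ.nodeOK u a b
    nodeOK-double u a b = T-⇔⇒≡ f g
      where
      f : T (Nodes2τ.nodeOK (double u) (double a) (double b)) → T (Nodesτ.nodeOK u a b)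
      f q with Nodes2τ.nodeOK-elim (double u) (double a) (double b) q
      ... | h0 , h1 , h2 , h3 = Nodesτ.nodeOK-intro u a b (double≤double+double⇒≤ u a b h0 , double≤double+double⇒≤ a u b h1 , double≤double+double⇒≤ b u a h2 ,
              double-cancel-≤ (subst₂ _≤_ (double-+₃ u a b) double-τ+τ h3))
      g : T (Nodesτ.nodeOK u a b) → T (Nodes2τ.nodeOK (double u) (double a) (double b))
      g q with Nodesτ.nodeOK-elim u a b q
      ... | h0 , h1 , h2 , h3 = Nodes2τ.nodeOK-intro (double u) (double a) (double b) (≤+⇒double≤double+double u a b h0 , ≤+⇒double≤double+double a u b h1 , ≤+⇒double≤double+double b u a h2 ,
              subst₂ _≤_ (sym (double-+₃ u a b)) (sym double-τ+τ) (double-mono-≤ h3))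

    Σσ-nodeOK : ∀ a b → [ even a ] * [ even b ] * ΣN B (λ x → σ x * [ Nodes2τ.nodeOK x a b ]) ≡ σ a * σ b
    Σσ-nodeOK a b = by-parity (even a) (even b) refl refl
      where
      S : ℤ
      S = ΣN B (λ x → σ x * [ Nodes2τ.nodeOK x a b ])
      by-parity : ∀ x y → even a ≡ x → even b ≡ y → [ even a ] * [ even b ] * S ≡ σ a * σ b
      by-parity false y ea eb = trans (cong (λ z → [ z ] * [ even b ] * S) ea)
                            (trans (trans (cong (_* S) (ℤP.*-zeroˡ [ even b ])) (ℤP.*-zeroˡ S))
                            (sym (trans (cong (_* σ b) (σ-odd a ea)) (ℤP.*-zeroˡ (σ b)))))
      by-parity true false ea eb = trans (cong (λ z → [ even a ] * [ z ] * S) eb)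
                            (trans (trans (cong (_* S) (ℤP.*-zeroʳ [ even a ])) (ℤP.*-zeroˡ S))
                            (sym (trans (cong (σ a *_) (σ-odd b eb)) (ℤP.*-zeroʳ (σ a)))))
      by-parity true true ea eb = begin
        [ even a ] * [ even b ] * S
          ≡⟨ cong₂ (λ p q → [ p ] * [ q ] * S) ea eb ⟩
        1ℤ * 1ℤ * S
          ≡⟨ ℤP.*-identityˡ S ⟩
        ΣN B (λ x → σ x * [ Nodes2τ.nodeOK x a b ])
          ≡⟨ ΣN-ext B (λ x → ℤP.*-assoc [ even x ] (truncSign (half x)) [ Nodes2τ.nodeOK x a b ]) ⟩
        ΣN B (λ x → [ even x ] * (truncSign (half x) * [ Nodes2τ.nodeOK x a b ]))
          ≡⟨ Σ-even τ (λ x → truncSign (half x) * [ Nodes2τ.nodeOK x a b ]) ⟩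
        ΣN (suc τ) (λ u → truncSign (half (double u)) * [ Nodes2τ.nodeOK (double u) a b ])
          ≡⟨ ΣN-cong (suc τ) (λ u u< → cong₂ (λ z w → z * [ w ]) (trans (cong truncSign (half-double u)) (truncSign-≤ u u<))
                         (trans (cong₂ (Nodes2τ.nodeOK (double u)) (sym (even⇒double-half a (subst T (sym ea) tt))) (sym (even⇒double-half b (subst T (sym eb) tt))))
                                (nodeOK-double u (half a) (half b)))) ⟩
        ΣN (suc τ) (λ u → sign u * [ Nodesτ.nodeOK u (half a) (half b) ])
          ≡⟨ Σ-sign-nodeOK (half a) (half b) ⟩
        truncSign (half a) * truncSign (half b)
          ≡⟨ sym (cong₂ _*_ (ℤP.*-identityˡ (truncSign (half a))) (ℤP.*-identityˡ (truncSign (half b)))) ⟩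
        [ true ] * truncSign (half a) * ([ true ] * truncSign (half b))
          ≡⟨ cong₂ (λ p q → [ p ] * truncSign (half a) * ([ q ] * truncSign (half b))) (sym ea) (sym eb) ⟩
        σ a * σ b ∎
        where open ≡-Reasoning

    open SpineConditions (double τ) using (loopNodeOK; parityOK)

    -- The number of admissible values on a loop whose leg carries y, odd ones iff b (the loop is in H).
    loopCount : Bool → ℕ → ℤ
    loopCount b y = ΣN B (λ x → [ loopOK b x y ])

    weighted : (ℕ → ℤ) → ℤ
    weighted g = ΣN B (λ y → σ y * g y)

    weighted-even : ∀ g → weighted g ≡ ΣN (suc τ) (λ u → sign u * g (double u))
    weighted-even g = trans (ΣN-ext B (λ y → ℤP.*-assoc [ even y ] (truncSign (half y)) (g y)))
               (trans (Σ-even τ (λ y → truncSign (half y) * g y))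
                 (ΣN-cong (suc τ) (λ u u< → cong (_* g (double u)) (trans (cong truncSign (half-double u)) (truncSign-≤ u u<)))))

    weighted-one : weighted (λ _ → 1ℤ) ≡ [ even τ ]
    weighted-one = trans (weighted-even (λ _ → 1ℤ)) (trans (ΣN-ext (suc τ) (λ u → ℤP.*-identityʳ (sign u))) (Σ-sign≡even τ))

    loopNodeOK-double-elim : ∀ x u → T (loopNodeOK x (double u)) → (u ≤ x) × (x ℕ.+ u ≤ double τ)
    loopNodeOK-double-elim x u q with Nodes2τ.loopNodeOK-elim x (double u) q
    ... | h0 , h1 = double-cancel-≤ (subst (double u ≤_) (sym (double≡+ x)) h0) ,
                    double-cancel-≤ (subst₂ _≤_ (e x u) (sym (double≡+ (double τ))) h1)
      where
      e : ∀ x u → x ℕ.+ x ℕ.+ double u ≡ double (x ℕ.+ u)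
      e x u = trans (cong₂ (λ a b → a ℕ.+ b) (sym (double≡+ x)) refl) (sym (double-+ x u))

    loopNodeOK-double-intro : ∀ x u → u ≤ x → x ℕ.+ u ≤ double τ → T (loopNodeOK x (double u))
    loopNodeOK-double-intro x u h0 h1 = Nodes2τ.loopNodeOK-intro x (double u) (subst (double u ≤_) (double≡+ x) (double-mono-≤ h0) ,
                                          subst₂ _≤_ (sym (e x u)) (double≡+ (double τ)) (double-mono-≤ h1))
      where
      e : ∀ x u → x ℕ.+ x ℕ.+ double u ≡ double (x ℕ.+ u)
      e x u = trans (cong₂ (λ a b → a ℕ.+ b) (sym (double≡+ x)) refl) (sym (double-+ x u))

    loopNodeOK-interval : ∀ u e → τ ≡ u ℕ.+ e → ∀ x → loopNodeOK x (double u) ≡ ((u ≤ᵇ x) ∧ (x ≤ᵇ u ℕ.+ (e ℕ.+ e)))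
    loopNodeOK-interval u e eq x = T-⇔⇒≡ f g
      where
      de : double τ ≡ u ℕ.+ (e ℕ.+ e) ℕ.+ u
      de = trans (double≡+ τ) (trans (cong₂ ℕ._+_ eq eq) (r u e))
        where
        r : ∀ u e → u ℕ.+ e ℕ.+ (u ℕ.+ e) ≡ u ℕ.+ (e ℕ.+ e) ℕ.+ u
        r = NS.solve-∀
      f : T (loopNodeOK x (double u)) → T ((u ≤ᵇ x) ∧ (x ≤ᵇ u ℕ.+ (e ℕ.+ e)))
      f q with loopNodeOK-double-elim x u q
      ... | h0 , h1 = ≤ᵇ∧≤ᵇ-intro h0 (ℕP.+-cancelʳ-≤ u x (u ℕ.+ (e ℕ.+ e)) (subst (x ℕ.+ u ≤_) de h1))
      g : T ((u ≤ᵇ x) ∧ (x ≤ᵇ u ℕ.+ (e ℕ.+ e))) → T (loopNodeOK x (double u))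
      g q with ≤ᵇ∧≤ᵇ-elim u x x (u ℕ.+ (e ℕ.+ e)) q
      ... | h0 , h1 = loopNodeOK-double-intro x u h0 (subst (x ℕ.+ u ≤_) (sym de) (ℕP.+-monoˡ-≤ u h1))

    loopNodeOK-empty : ∀ u → τ < u → ∀ x → loopNodeOK x (double u) ≡ false
    loopNodeOK-empty u lt x = T-⇔⇒≡ {b = false} f (λ ())
      where
      f : T (loopNodeOK x (double u)) → T false
      f q with loopNodeOK-double-elim x u q
      ... | h0 , h1 = ℕP.<⇒≱ lt (m+m≤n+n⇒m≤n u τ (ℕP.≤-trans (ℕP.+-monoˡ-≤ u h0) (subst (x ℕ.+ u ≤_) (double≡+ τ) h1)))

    -- The loop values compatible with the leg value 2u ≤ 2τ form the interval [u, 2τ - u], whose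
    -- alternating sum is sign u.
    Σ-sign-loopNodeOK : ∀ u → ΣN B (λ x → sign x * [ loopNodeOK x (double u) ]) ≡ truncSign u
    Σ-sign-loopNodeOK u with u ℕP.≤? τ
    ... | yes le with ℕP.m≤n⇒∃[o]m+o≡n le
    ...   | e' , eq = trans (Σ-sign-interval B u (e' ℕ.+ e') _ (s≤s bd) (λ x _ → loopNodeOK-interval u e' (sym eq) x))
                        (trans (cong (λ b → [ b ] * sign u) (even-n+n e')) (trans (ℤP.*-identityˡ (sign u)) (sym (truncSign-≤ u (s≤s le)))))
      where
      bd : u ℕ.+ (e' ℕ.+ e') ≤ double τ
      bd = subst (u ℕ.+ (e' ℕ.+ e') ≤_) (sym (trans (double≡+ τ) (cong₂ ℕ._+_ (sym eq) (sym eq))))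
             (subst (u ℕ.+ (e' ℕ.+ e') ≤_) (r u e') (ℕP.m≤n+m (u ℕ.+ (e' ℕ.+ e')) u))
        where
        r : ∀ u e → u ℕ.+ (u ℕ.+ (e ℕ.+ e)) ≡ u ℕ.+ e ℕ.+ (u ℕ.+ e)
        r = NS.solve-∀
    Σ-sign-loopNodeOK u | no ¬le = trans (Σ-sign-empty B _ (λ x _ → loopNodeOK-empty u (ℕP.≰⇒> ¬le) x))
                     (sym (trans (cong (λ b → [ b ] * sign u) (≤ᵇ-false _ _ (ℕP.≰⇒> ¬le))) (ℤP.*-zeroˡ (sign u))))

    loopOK-difference : ∀ x y → [ loopOK false x y ] - [ loopOK true x y ] ≡ sign x * [ loopNodeOK x y ]
    loopOK-difference x y = begin
      [ loopNodeOK x y ∧ even x ] - [ loopNodeOK x y ∧ not (even x) ]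
        ≡⟨ cong₂ _-_ ([∧] (loopNodeOK x y) (even x)) ([∧] (loopNodeOK x y) (not (even x))) ⟩
      [ loopNodeOK x y ] * [ even x ] - [ loopNodeOK x y ] * [ not (even x) ]
        ≡⟨ sym (x[y-z]≈xy-xz [ loopNodeOK x y ] [ even x ] [ not (even x) ]) ⟩
      [ loopNodeOK x y ] * ([ even x ] - [ not (even x) ])
        ≡⟨ cong ([ loopNodeOK x y ] *_) (even-odd≡sign x) ⟩
      [ loopNodeOK x y ] * sign x
        ≡⟨ ℤP.*-comm [ loopNodeOK x y ] (sign x) ⟩
      sign x * [ loopNodeOK x y ] ∎
      where open ≡-Reasoning

    loopCount-difference : ∀ y → [ even y ] * (loopCount false y - loopCount true y) ≡ σ y
    loopCount-difference y = by-parity (even y) refl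
      where
      by-parity : ∀ b → even y ≡ b → [ even y ] * (loopCount false y - loopCount true y) ≡ σ y
      by-parity false e = trans (cong (λ b → [ b ] * (loopCount false y - loopCount true y)) e) (sym (σ-odd y e))
      by-parity true e = begin
        [ even y ] * (loopCount false y - loopCount true y)      ≡⟨ cong (λ b → [ b ] * (loopCount false y - loopCount true y)) e ⟩
        1ℤ * (loopCount false y - loopCount true y)             ≡⟨ ℤP.*-identityˡ _ ⟩
        loopCount false y - loopCount true y                     ≡⟨ sym (ΣN-- B (λ x → [ loopOK false x y ]) (λ x → [ loopOK true x y ])) ⟩
        ΣN B (λ x → [ loopOK false x y ] - [ loopOK true x y ]) ≡⟨ ΣN-ext B (λ x → loopOK-difference x y) ⟩
        ΣN B (λ x → sign x * [ loopNodeOK x y ])                 ≡⟨ cong (λ z → ΣN B (λ x → sign x * [ loopNodeOK x z ])) (sym y≡2u) ⟩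
        ΣN B (λ x → sign x * [ loopNodeOK x (double u) ])        ≡⟨ Σ-sign-loopNodeOK u ⟩
        truncSign u                                              ≡⟨ sym (σ-double u) ⟩
        σ (double u)                                             ≡⟨ cong σ y≡2u ⟩
        σ y                                                      ∎
        where
        open ≡-Reasoning
        u = half y
        y≡2u : double u ≡ y
        y≡2u = even⇒double-half y (subst T (sym e) tt)

    loopNodeOK-double : ∀ χ e → τ ≡ χ ℕ.+ e → ∀ hi → ((hi ≡ double χ) × χ ≤ e) ⊎ ((hi ≡ double e) × e ≤ χ) → ∀ u →
           loopNodeOK (double χ) (double u) ≡ (u ≤ᵇ hi)
    loopNodeOK-double χ e eq .(double χ) (inj₁ (refl , le)) u = T-⇔⇒≡ f g
      where
      dτ : double τ ≡ double χ ℕ.+ double e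
      dτ = trans (cong double eq) (double-+ χ e)
      f : T (loopNodeOK (double χ) (double u)) → T (u ≤ᵇ double χ)
      f q = ℕP.≤⇒≤ᵇ (proj₁ (loopNodeOK-double-elim (double χ) u q))
      g : T (u ≤ᵇ double χ) → T (loopNodeOK (double χ) (double u))
      g q = loopNodeOK-double-intro (double χ) u (≤ᵇ⇒≤ q) (subst (double χ ℕ.+ u ≤_) (sym dτ)
                                 (ℕP.+-monoʳ-≤ (double χ) (ℕP.≤-trans (≤ᵇ⇒≤ q) (double-mono-≤ le))))
    loopNodeOK-double χ e eq .(double e) (inj₂ (refl , le)) u = T-⇔⇒≡ f g
      where
      dτ : double τ ≡ double χ ℕ.+ double e
      dτ = trans (cong double eq) (double-+ χ e)
      f : T (loopNodeOK (double χ) (double u)) → T (u ≤ᵇ double e)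
      f q = ℕP.≤⇒≤ᵇ (ℕP.+-cancelˡ-≤ (double χ) u (double e) (subst (double χ ℕ.+ u ≤_) dτ (proj₂ (loopNodeOK-double-elim (double χ) u q))))
      g : T (u ≤ᵇ double e) → T (loopNodeOK (double χ) (double u))
      g q = loopNodeOK-double-intro (double χ) u (ℕP.≤-trans (≤ᵇ⇒≤ q) (double-mono-≤ le))
                                 (subst (double χ ℕ.+ u ≤_) (sym dτ) (ℕP.+-monoʳ-≤ (double χ) (≤ᵇ⇒≤ q)))

    -- After swapping the sums each even loop value 2χ contributes the alternating sum over
    -- [0, 2 min(χ, τ - χ)], which is 1.
    weighted-loopCount : weighted (loopCount false) ≡ + (suc τ)
    weighted-loopCount = begin
      weighted (loopCount false)
        ≡⟨ weighted-even (loopCount false) ⟩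
      ΣN (suc τ) (λ u → sign u * loopCount false (double u))
        ≡⟨ ΣN-ext (suc τ) (λ u → cong (sign u *_) (loopCount-even u)) ⟩
      ΣN (suc τ) (λ u → sign u * ΣN (suc τ) (λ χ → admissible χ u))
        ≡⟨ ΣN-ext (suc τ) (λ u → sym (ΣN-*ˡ (suc τ) (sign u) (λ χ → admissible χ u))) ⟩
      ΣN (suc τ) (λ u → ΣN (suc τ) (λ χ → sign u * admissible χ u))
        ≡⟨ ΣN-swap (suc τ) (suc τ) (λ u χ → sign u * admissible χ u) ⟩
      ΣN (suc τ) (λ χ → ΣN (suc τ) (λ u → sign u * admissible χ u))
        ≡⟨ ΣN-cong (suc τ) inner ⟩
      ΣN (suc τ) (λ _ → 1ℤ)
        ≡⟨ ΣN-one (suc τ) ⟩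
      + suc τ ∎
      where
      open ≡-Reasoning
      admissible : ℕ → ℕ → ℤ
      admissible χ u = [ loopNodeOK (double χ) (double u) ]
      loopCount-even : ∀ u → loopCount false (double u) ≡ ΣN (suc τ) (λ χ → admissible χ u)
      loopCount-even u = trans (ΣN-ext B (λ x → trans ([∧] (loopNodeOK x (double u)) (even x)) (ℤP.*-comm [ loopNodeOK x (double u) ] [ even x ])))
                   (Σ-even τ (λ x → [ loopNodeOK x (double u) ]))
      inner : ∀ χ → χ < suc τ → ΣN (suc τ) (λ u → sign u * admissible χ u) ≡ 1ℤ
      inner χ (s≤s χ≤τ) with ℕP.m≤n⇒∃[o]m+o≡n χ≤τ
      ... | e , eq with ℕP.≤-total χ e
      ...   | inj₁ le = trans (Σ-sign-interval (suc τ) 0 (double χ) _ (s≤s bd) (λ u _ → loopNodeOK-double χ e (sym eq) (double χ) (inj₁ (refl , le)) u))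
                          (cong (λ b → [ b ] * 1ℤ) (even-double χ))
        where
        bd : double χ ≤ τ
        bd = subst (double χ ≤_) eq (subst (_≤ χ ℕ.+ e) (sym (double≡+ χ)) (ℕP.+-monoʳ-≤ χ le))
      ...   | inj₂ le = trans (Σ-sign-interval (suc τ) 0 (double e) _ (s≤s bd) (λ u _ → loopNodeOK-double χ e (sym eq) (double e) (inj₂ (refl , le)) u))
                          (cong (λ b → [ b ] * 1ℤ) (even-double e))
        where
        bd : double e ≤ τ
        bd = subst (double e ≤_) eq (subst (_≤ χ ℕ.+ e) (sym (double≡+ e)) (ℕP.+-monoˡ-≤ e le))


module CaterpillarEdges where

  open import Defs
  open Sums
  open Parity
  open LatticePoints
  open CaterpillarPoints
  open import Data.Nat as ℕ using (ℕ; zero; suc; _≤_; _<_)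
  import Data.Nat.Properties as ℕP
  open import Data.Bool using (true; false)
  open import Data.Empty using (⊥-elim)
  open import Data.Fin using (Fin; zero; suc; _↑ˡ_; _↑ʳ_; inject₁; toℕ; fromℕ; fromℕ<; splitAt)
  import Data.Fin.Properties as FinP
  open import Data.Fin.Subset using (⁅_⁆; ⊥)
  open import Data.Vec using (lookup)
  import Data.Vec.Properties as VP
  open import Data.Product using (Σ; _×_; _,_; proj₁; proj₂)
  open import Data.Sum using (_⊎_; inj₁; inj₂)
  open import Relation.Binary.PropositionalEquality hiding ([_])
  open import Relation.Nullary using (¬_; yes; no)

  lookup⊥ : ∀ {n} (e : Fin n) → lookup (⊥ {n}) e ≡ false
  lookup⊥ e = VP.lookup-replicate e false

  lookup⁅⁆≢ : ∀ {n} (i j : Fin n) → ¬ (i ≡ j) → lookup ⁅ i ⁆ j ≡ false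
  lookup⁅⁆≢ zero zero ne = ⊥-elim (ne refl)
  lookup⁅⁆≢ zero (suc j) ne = lookup⊥ j
  lookup⁅⁆≢ (suc i) zero ne = refl
  lookup⁅⁆≢ (suc i) (suc j) ne = lookup⁅⁆≢ i j (λ eq → ne (cong suc eq))

  lookup⁅⁆≡ : ∀ {n} (i : Fin n) → lookup ⁅ i ⁆ i ≡ true
  lookup⁅⁆≡ zero = refl
  lookup⁅⁆≡ (suc i) = lookup⁅⁆≡ i

  inj-or-last : ∀ {n} (j : Fin (suc n)) → (Σ (Fin n) λ j' → j ≡ inject₁ j') ⊎ j ≡ fromℕ n
  inj-or-last {zero} zero = inj₂ refl
  inj-or-last {suc n} zero = inj₁ (zero , refl)
  inj-or-last {suc n} (suc j) with inj-or-last {n} j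
  ... | inj₁ (j' , eq) = inj₁ (suc j' , cong suc eq)
  ... | inj₂ eq = inj₂ (cong suc eq)

  -- The predicate Occ2 of IsLoop (local to Defs).
  OccursTwice : ∀ {n} → Fin n → Fin n × Fin n × Fin n → Set
  OccursTwice e tr = (proj₁ tr ≡ e × proj₁ (proj₂ tr) ≡ e) ⊎ (proj₁ tr ≡ e × proj₂ (proj₂ tr) ≡ e) ⊎ (proj₁ (proj₂ tr) ≡ e × proj₂ (proj₂ tr) ≡ e)

  module Edges (t m k : ℕ) where
    open Coordinates t m k

    toℕP : ∀ j → toℕ (P j) ≡ toℕ j
    toℕP j = FinP.toℕ-↑ˡ j (m ℕ.+ k)

    toℕM : ∀ j → toℕ (M j) ≡ suc m ℕ.+ toℕ j
    toℕM j = trans (FinP.toℕ-↑ʳ (suc m) (j ↑ˡ k)) (cong (suc m ℕ.+_) (FinP.toℕ-↑ˡ j k))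

    toℕL : ∀ i → toℕ (L i) ≡ suc m ℕ.+ (m ℕ.+ toℕ i)
    toℕL i = trans (FinP.toℕ-↑ʳ (suc m) (m ↑ʳ i)) (cong (suc m ℕ.+_) (FinP.toℕ-↑ʳ m i))

    P≢M : ∀ j j' → ¬ (P j ≡ M j')
    P≢M j j' eq = ℕP.<⇒≢ (ℕP.<-≤-trans (FinP.toℕ<n j) (ℕP.m≤m+n (suc m) (toℕ j')))
                    (trans (sym (toℕP j)) (trans (cong toℕ eq) (toℕM j')))

    P≢L : ∀ j i → ¬ (P j ≡ L i)
    P≢L j i eq = ℕP.<⇒≢ (ℕP.<-≤-trans (FinP.toℕ<n j) (ℕP.m≤m+n (suc m) (m ℕ.+ toℕ i)))
                    (trans (sym (toℕP j)) (trans (cong toℕ eq) (toℕL i)))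

    M≢L : ∀ j i → ¬ (M j ≡ L i)
    M≢L j i eq = ℕP.<⇒≢ (ℕP.+-monoʳ-< (suc m) (ℕP.<-≤-trans (FinP.toℕ<n j) (ℕP.m≤m+n m (toℕ i))))
                    (trans (sym (toℕM j)) (trans (cong toℕ eq) (toℕL i)))

    P-inj : ∀ j j' → P j ≡ P j' → j ≡ j'
    P-inj j j' = FinP.↑ˡ-injective (m ℕ.+ k) j j'

    L-inj : ∀ i i' → L i ≡ L i' → i ≡ i'
    L-inj i i' eq = FinP.↑ʳ-injective m i i' (FinP.↑ʳ-injective (suc m) (m ↑ʳ i) (m ↑ʳ i') eq)

    inject₁≢suc : ∀ {n} (j : Fin n) → ¬ (inject₁ j ≡ suc j)
    inject₁≢suc j eq = ℕP.1+n≢n (sym (trans (sym (FinP.toℕ-inject₁ j)) (cong toℕ eq)))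

    incident-node : 1 ≤ k → ∀ e → Σ (Fin (m ℕ.+ k)) λ v → IncidentTo e (incid v)
    incident-node k≥1 e with splitAt (suc m) e in eq
    ... | inj₁ j = coverP j (sym (FinP.splitAt⁻¹-↑ˡ eq))
      where
      coverP : ∀ j → e ≡ P j → Σ (Fin (m ℕ.+ k)) λ v → IncidentTo e (incid v)
      coverP j e≡ with inj-or-last j
      ... | inj₁ (j' , refl) = (j' ↑ˡ k) , subst (IncidentTo e) (sym (incid-spine j')) (inj₁ e≡)
      ... | inj₂ refl with m ℕP.≟ 0
      ...   | yes m≡0 = (m ↑ʳ i0) , subst (IncidentTo e) (sym (incid-loop i0)) (inj₂ (inj₂ (trans e≡ (trans (cong P fz) (sym legEq)))))
        where
        i0 : Fin k
        i0 = fromℕ< k≥1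
        toℕi0 : toℕ i0 ≡ 0
        toℕi0 = FinP.toℕ-fromℕ< k≥1
        fz : fromℕ m ≡ zero
        fz = FinP.toℕ-injective (trans (FinP.toℕ-fromℕ m) m≡0)
        legEq : leg (toℕ i0) ≡ P zero
        legEq = cong leg toℕi0
      ...   | no m≢0 = (c ↑ˡ k) , subst (IncidentTo e) (sym (incid-spine c)) (inj₂ (inj₁ (trans e≡ (cong P (sym sc)))))
        where
        lt : ℕ.pred m < m
        lt = subst (ℕ.pred m <_) (ℕP.suc-pred m {{ℕ.≢-nonZero m≢0}}) (ℕP.n<1+n (ℕ.pred m))
        c : Fin m
        c = fromℕ< lt
        sc : suc c ≡ fromℕ m
        sc = FinP.toℕ-injective (trans (cong suc (FinP.toℕ-fromℕ< lt)) (trans (ℕP.suc-pred m {{ℕ.≢-nonZero m≢0}}) (sym (FinP.toℕ-fromℕ m))))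
    ... | inj₂ r with splitAt m r in eq2
    ...   | inj₁ j = (j ↑ˡ k) , subst (IncidentTo e) (sym (incid-spine j))
                       (inj₂ (inj₂ (trans (sym (FinP.splitAt⁻¹-↑ʳ eq)) (cong (suc m ↑ʳ_) (sym (FinP.splitAt⁻¹-↑ˡ eq2))))))
    ...   | inj₂ i = (m ↑ʳ i) , subst (IncidentTo e) (sym (incid-loop i))
                       (inj₁ (trans (sym (FinP.splitAt⁻¹-↑ʳ eq)) (cong (suc m ↑ʳ_) (sym (FinP.splitAt⁻¹-↑ʳ eq2)))))

    ↑ˡ-or-↑ʳ : ∀ (v : Fin (m ℕ.+ k)) → (Σ (Fin m) λ j → v ≡ j ↑ˡ k) ⊎ (Σ (Fin k) λ i → v ≡ m ↑ʳ i)
    ↑ˡ-or-↑ʳ v with splitAt m v in eq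
    ... | inj₁ j = inj₁ (j , sym (FinP.splitAt⁻¹-↑ˡ eq))
    ... | inj₂ i = inj₂ (i , sym (FinP.splitAt⁻¹-↑ʳ eq))

    loop⇒L : ∀ e (v : Fin (m ℕ.+ k)) → OccursTwice e (incid v) → Σ (Fin k) λ i → e ≡ L i
    loop⇒L e v occ with ↑ˡ-or-↑ʳ v
    ... | inj₁ (j , refl) = ⊥-elim (not-spine (subst (OccursTwice e) (incid-spine j) occ))
      where
      not-spine : ¬ OccursTwice e (P (inject₁ j) , P (suc j) , M j)
      not-spine (inj₁ (a , b)) = inject₁≢suc j (P-inj _ _ (trans a (sym b)))
      not-spine (inj₂ (inj₁ (a , c))) = P≢M _ _ (trans a (sym c))
      not-spine (inj₂ (inj₂ (b , c))) = P≢M _ _ (trans b (sym c))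
    ... | inj₂ (i , refl) = i , loop-edge (subst (OccursTwice e) (incid-loop i) occ)
      where
      loop-edge : OccursTwice e (L i , L i , leg (toℕ i)) → e ≡ L i
      loop-edge (inj₁ (a , _)) = sym a
      loop-edge (inj₂ (inj₁ (a , _))) = sym a
      loop-edge (inj₂ (inj₂ (b , _))) = sym b

    ≡ᵇ-refl : ∀ n → (n ℕ.≡ᵇ n) ≡ true
    ≡ᵇ-refl n = T⇒≡true (ℕP.≡⇒≡ᵇ n n refl)

    ≡ᵇ-false : ∀ a b → ¬ (a ≡ b) → (a ℕ.≡ᵇ b) ≡ false
    ≡ᵇ-false a b ne with a ℕ.≡ᵇ b in eq
    ... | true = ⊥-elim (ne (ℕP.≡ᵇ⇒≡ a b (≡true⇒T eq)))
    ... | false = refl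

    module SingleLoop (sp : Fin k) where
      P∉⁅L⁆ : ∀ j → lookup ⁅ L sp ⁆ (P j) ≡ false
      P∉⁅L⁆ j = lookup⁅⁆≢ (L sp) (P j) (λ eq → P≢L j sp (sym eq))
      M∉⁅L⁆ : ∀ j → lookup ⁅ L sp ⁆ (M j) ≡ false
      M∉⁅L⁆ j = lookup⁅⁆≢ (L sp) (M j) (λ eq → M≢L j sp (sym eq))
      L∈⁅L⁆ : ∀ i → lookup ⁅ L sp ⁆ (L i) ≡ (toℕ i ℕ.≡ᵇ toℕ sp)
      L∈⁅L⁆ i with i FinP.≟ sp
      ... | yes refl = trans (lookup⁅⁆≡ (L i)) (sym (≡ᵇ-refl (toℕ i)))
      ... | no ne = trans (lookup⁅⁆≢ (L sp) (L i) (λ eq → ne (sym (L-inj _ _ eq))))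
                          (sym (≡ᵇ-false (toℕ i) (toℕ sp) (λ eq → ne (FinP.toℕ-injective eq))))


module VolumeDifference where

  open import Defs
  open Sums
  open Parity
  open LatticePoints
  open CaterpillarPoints
  open SpineCollapse
  open AlternatingSums
  open LoopWeights
  open CaterpillarEdges
  open import Data.Nat as ℕ using (ℕ; zero; suc; _≤_; _<_; z≤n; s≤s; _^_)
  import Data.Nat.Properties as ℕP
  open import Data.Integer using (ℤ; +_; 1ℤ; _+_; _*_; -_; _-_)
  import Data.Integer.Properties as ℤP
  open import Data.Integer.Tactic.RingSolver
  open import Data.Bool using (Bool; true; false; _∧_; if_then_else_)
  open import Data.Empty using (⊥-elim)
  open import Data.Fin using (Fin; zero; suc; toℕ)
  import Data.Fin.Properties as FinP
  open import Data.Fin.Subset using (Subset; ⁅_⁆; ⊥)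
  open import Data.Vec using (Vec; _∷_; lookup; _++_)
  open import Data.List using (length)
  open import Data.Product using (Σ; _×_; _,_)
  open import Data.Sum using (_⊎_; inj₁; inj₂)
  open import Relation.Nullary using (¬_; yes; no)
  open import Relation.Binary.PropositionalEquality hiding ([_])
  open ≡-Reasoning

  allFin-product : ∀ n (f : Fin n → Bool) → [ allFin n f ] ≡ ΠF n (λ i → [ f i ])
  allFin-product zero f = refl
  allFin-product (suc n) f = trans ([∧] (f zero) _) (cong ([ f zero ] *_) (allFin-product n (λ i → f (suc i))))

  <ᵇ-true : ∀ a b → a < b → (a ℕ.<ᵇ b) ≡ true
  <ᵇ-true a b lt = T⇒≡true (ℕP.<⇒<ᵇ lt)

  <ᵇ-false : ∀ a b → ¬ (a < b) → (a ℕ.<ᵇ b) ≡ false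
  <ᵇ-false a b nlt with a ℕ.<ᵇ b in eq
  ... | true = ⊥-elim (nlt (ℕP.<ᵇ⇒< a b (≡true⇒T eq)))
  ... | false = refl

  module Setup (h k' τ : ℕ) (hk : 2 ≤ h ℕ.+ suc k') (sp : Fin (suc k')) where
    k : ℕ
    k = suc k'
    m : ℕ
    m = h ℕ.+ k ℕ.∸ 2
    t : ℕ
    t = double τ
    B : ℕ
    B = suc t
    marked : ℕ
    marked = toℕ sp

    open Coordinates t m k
    open Edges t m k
    module LW = LoopWeights.Weights τ
    open LW using (σ; loopCount; weighted; Σσ-nodeOK; weighted-loopCount; weighted-one; loopCount-difference)
    module SC = Collapse t B σ Σσ-nodeOK
    open BoxSums B

    incident : ∀ e → Σ (Fin (m ℕ.+ k)) λ v → IncidentTo e (incid v)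
    incident = incident-node (s≤s z≤n)

    module Points₀ = Characterisation ⊥ (λ _ → false) (λ j → lookup⊥ (P j)) (λ j → lookup⊥ (M j)) (λ i → lookup⊥ (L i)) incident
    module Points₁ = Characterisation ⁅ L sp ⁆ (λ i → toℕ i ℕ.≡ᵇ marked) (SingleLoop.P∉⁅L⁆ sp) (SingleLoop.M∉⁅L⁆ sp) (SingleLoop.L∈⁅L⁆ sp) incident

    legAt : ℕ → Vec ℕ m → Vec ℕ m → ℕ → ℕ
    legAt p ps ms l = legValue l (p ∷ ps) ms

    -- Given the spine values, the loop values are independent, so they can be summed out.
    countSum : (Fin k → Bool) → ℤ
    countSum hb = ΣN B λ p → SumV m λ ps → SumV m λ ms →
      [ even p ] * ([ spineOK p ps ms ] * ΠF k (λ i → loopCount (hb i) (legAt p ps ms (toℕ i))))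

    module CountFormula (H : Subset NE) (hb : Fin k → Bool)
               (hP : ∀ j → lookup H (P j) ≡ false) (hM : ∀ j → lookup H (M j) ≡ false)
               (hL : ∀ i → lookup H (L i) ≡ hb i) where
      open Characterisation H hb hP hM hL incident using (points; length-points; IsPoint?; indicator-IsPoint)

      sum-out-loops : ∀ p ps ms → SumV k (λ ls → indicator (IsPoint? ((p ∷ ps) ++ (ms ++ ls))))
                          ≡ [ even p ] * ([ spineOK p ps ms ] * ΠF k (λ i → loopCount (hb i) (legAt p ps ms (toℕ i))))
      sum-out-loops p ps ms = begin
        SumV k (λ ls → indicator (IsPoint? ((p ∷ ps) ++ (ms ++ ls))))
          ≡⟨ SumV-ext k (λ ls → trans (indicator-IsPoint p ps ms ls) (trans ([∧] (even p) (spineOK p ps ms ∧ allFin k (λ i → lp i (lookup ls i)))) (cong ([ even p ] *_)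
                (trans ([∧] (spineOK p ps ms) (allFin k (λ i → lp i (lookup ls i)))) (cong ([ spineOK p ps ms ] *_) (allFin-product k (λ i → lp i (lookup ls i)))))))) ⟩
        SumV k (λ ls → [ even p ] * ([ spineOK p ps ms ] * ΠF k (λ i → [ lp i (lookup ls i) ])))
          ≡⟨ SumV-*ˡ k [ even p ] (λ ls → [ spineOK p ps ms ] * ΠF k (λ i → [ lp i (lookup ls i) ])) ⟩
        [ even p ] * SumV k (λ ls → [ spineOK p ps ms ] * ΠF k (λ i → [ lp i (lookup ls i) ]))
          ≡⟨ cong ([ even p ] *_) (SumV-*ˡ k [ spineOK p ps ms ] (λ ls → ΠF k (λ i → [ lp i (lookup ls i) ]))) ⟩
        [ even p ] * ([ spineOK p ps ms ] * SumV k (λ ls → ΠF k (λ i → [ lp i (lookup ls i) ])))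
          ≡⟨ cong (λ z → [ even p ] * ([ spineOK p ps ms ] * z)) (SumV-ΠF k (λ i x → [ lp i x ])) ⟩
        [ even p ] * ([ spineOK p ps ms ] * ΠF k (λ i → loopCount (hb i) (legAt p ps ms (toℕ i)))) ∎
        where
        lp : Fin k → ℕ → Bool
        lp i x = loopOK (hb i) x (legValue (toℕ i) (p ∷ ps) ms)

      length-points≡countSum : + length points ≡ countSum hb
      length-points≡countSum = begin
        + length points
          ≡⟨ length-points ⟩
        SumV (suc (m ℕ.+ (m ℕ.+ k))) (λ w → indicator (IsPoint? w))
          ≡⟨ ΣN-ext B (λ p → trans (SumV-++ m (m ℕ.+ k) (λ w → indicator (IsPoint? (p ∷ w)))) (SumV-ext m (λ ps → SumV-++ m k (λ r → indicator (IsPoint? (p ∷ (ps ++ r))))))) ⟩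
        ΣN B (λ p → SumV m λ ps → SumV m λ ms → SumV k λ ls → indicator (IsPoint? ((p ∷ ps) ++ (ms ++ ls))))
          ≡⟨ ΣN-ext B (λ p → SumV-ext m (λ ps → SumV-ext m (λ ms → sum-out-loops p ps ms))) ⟩
        countSum hb ∎

    length-points₀ : + length Points₀.points ≡ countSum (λ _ → false)
    length-points₀ = CountFormula.length-points≡countSum ⊥ (λ _ → false) (λ j → lookup⊥ (P j)) (λ j → lookup⊥ (M j)) (λ i → lookup⊥ (L i))

    length-points₁ : + length Points₁.points ≡ countSum (λ i → toℕ i ℕ.≡ᵇ marked)
    length-points₁ = CountFormula.length-points≡countSum ⁅ L sp ⁆ (λ i → toℕ i ℕ.≡ᵇ marked) (SingleLoop.P∉⁅L⁆ sp) (SingleLoop.M∉⁅L⁆ sp) (SingleLoop.L∈⁅L⁆ sp)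

    legFactor : ℕ → ℕ → ℤ
    legFactor l y = if l ℕ.<ᵇ k then (if l ℕ.≡ᵇ marked then loopCount false y - loopCount true y else loopCount false y) else 1ℤ

    marked<k : marked < k
    marked<k = FinP.toℕ<n sp

    legFactor-marked : ∀ y → legFactor marked y ≡ loopCount false y - loopCount true y
    legFactor-marked y = trans (cong (λ b → if b then (if marked ℕ.≡ᵇ marked then loopCount false y - loopCount true y else loopCount false y) else 1ℤ) (<ᵇ-true marked k marked<k))
                   (cong (λ b → if b then loopCount false y - loopCount true y else loopCount false y) (≡ᵇ-refl marked))

    legFactor-loop : ∀ l y → ¬ (l ≡ marked) → l < k → legFactor l y ≡ loopCount false y
    legFactor-loop l y ne lt = trans (cong (λ b → if b then (if l ℕ.≡ᵇ marked then loopCount false y - loopCount true y else loopCount false y) else 1ℤ) (<ᵇ-true l k lt))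
                   (cong (λ b → if b then loopCount false y - loopCount true y else loopCount false y) (≡ᵇ-false l marked ne))

    legFactor-plain : ∀ l y → ¬ (l < k) → legFactor l y ≡ 1ℤ
    legFactor-plain l y nlt = cong (λ b → if b then (if l ℕ.≡ᵇ marked then loopCount false y - loopCount true y else loopCount false y) else 1ℤ) (<ᵇ-false l k nlt)

    k+h≡m+2 : k ℕ.+ h ≡ suc (suc m)
    k+h≡m+2 = trans (ℕP.+-comm k h) (sym (trans (ℕP.+-comm 2 m) (ℕP.m∸n+n≡m hk)))

    restProduct : ℕ → Vec ℕ m → Vec ℕ m → ℤ
    restProduct p ps ms = ΠN (suc m) (λ l → legFactor (suc l) (legValue (suc l) (p ∷ ps) ms))

    legProduct-difference : ∀ p ps ms → ΠF k (λ i → loopCount false (legAt p ps ms (toℕ i))) - ΠF k (λ i → loopCount (toℕ i ℕ.≡ᵇ marked) (legAt p ps ms (toℕ i)))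
                     ≡ legFactor 0 p * restProduct p ps ms
    legProduct-difference p ps ms = begin
      ΠF k (λ i → loopCount false (y (toℕ i))) - ΠF k (λ i → loopCount (toℕ i ℕ.≡ᵇ marked) (y (toℕ i)))
        ≡⟨ cong₂ _-_ (ΠF-toℕ k (λ l → loopCount false (y l))) (ΠF-toℕ k (λ l → loopCount (l ℕ.≡ᵇ marked) (y l))) ⟩
      ΠN k (λ l → loopCount false (y l)) - ΠN k (λ l → loopCount (l ℕ.≡ᵇ marked) (y l))
        ≡⟨ ΠN-difference-at k marked (λ l b → loopCount b (y l)) marked<k ⟩
      ΠN k (λ l → if l ℕ.≡ᵇ marked then loopCount false (y l) - loopCount true (y l) else loopCount false (y l))
        ≡⟨ ΠN-cong k (λ l lt → sym (cong (λ b → if b then (if l ℕ.≡ᵇ marked then loopCount false (y l) - loopCount true (y l) else loopCount false (y l)) else 1ℤ) (<ᵇ-true l k lt))) ⟩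
      ΠN k (λ l → legFactor l (y l))
        ≡⟨ sym (ΠN-extend k h (λ l → legFactor l (y l)) (λ x → legFactor-plain (k ℕ.+ x) (y (k ℕ.+ x)) (λ lt → ℕP.<⇒≱ lt (ℕP.m≤m+n k x)))) ⟩
      ΠN (k ℕ.+ h) (λ l → legFactor l (y l))
        ≡⟨ cong (λ n → ΠN n (λ l → legFactor l (y l))) k+h≡m+2 ⟩
      legFactor 0 p * restProduct p ps ms ∎
      where
      y : ℕ → ℕ
      y = legAt p ps ms

    ρd : ∀ a b x z → a * (b * x) - a * (b * z) ≡ a * (b * (x - z))
    ρd = solve-∀

    ρe : ∀ a b g r → a * (b * (g * r)) ≡ (a * g) * (b * r)
    ρe = solve-∀

    difference≡spineSum : countSum (λ _ → false) - countSum (λ i → toℕ i ℕ.≡ᵇ marked) ≡ ΣN B (λ p → ([ even p ] * legFactor 0 p) * SC.spineSum legFactor m p)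
    difference≡spineSum = begin
      countSum (λ _ → false) - countSum (λ i → toℕ i ℕ.≡ᵇ marked)
        ≡⟨ sym (ΣN-- B (λ p → SumV m λ ps → SumV m λ ms → A p ps ms (Π0 p ps ms)) (λ p → SumV m λ ps → SumV m λ ms → A p ps ms (Π1 p ps ms))) ⟩
      ΣN B (λ p → (SumV m λ ps → SumV m λ ms → A p ps ms (Π0 p ps ms)) - (SumV m λ ps → SumV m λ ms → A p ps ms (Π1 p ps ms)))
        ≡⟨ ΣN-ext B (λ p → trans (sym (SumV-- m (λ ps → SumV m λ ms → A p ps ms (Π0 p ps ms)) (λ ps → SumV m λ ms → A p ps ms (Π1 p ps ms))))
                           (SumV-ext m (λ ps → sym (SumV-- m (λ ms → A p ps ms (Π0 p ps ms)) (λ ms → A p ps ms (Π1 p ps ms)))))) ⟩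
      ΣN B (λ p → SumV m λ ps → SumV m λ ms → A p ps ms (Π0 p ps ms) - A p ps ms (Π1 p ps ms))
        ≡⟨ ΣN-ext B (λ p → SumV-ext m (λ ps → SumV-ext m (λ ms →
              trans (ρd [ even p ] [ spineOK p ps ms ] (Π0 p ps ms) (Π1 p ps ms))
                (trans (cong (λ z → A p ps ms z) (legProduct-difference p ps ms)) (ρe [ even p ] [ spineOK p ps ms ] (legFactor 0 p) (restProduct p ps ms)))))) ⟩
      ΣN B (λ p → SumV m λ ps → SumV m λ ms → ([ even p ] * legFactor 0 p) * ([ spineOK p ps ms ] * restProduct p ps ms))
        ≡⟨ ΣN-ext B (λ p → trans (SumV-ext m (λ ps → SumV-*ˡ m ([ even p ] * legFactor 0 p) (λ ms → [ spineOK p ps ms ] * restProduct p ps ms)))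
                           (SumV-*ˡ m ([ even p ] * legFactor 0 p) (λ ps → SumV m λ ms → [ spineOK p ps ms ] * restProduct p ps ms))) ⟩
      ΣN B (λ p → ([ even p ] * legFactor 0 p) * SC.spineSum legFactor m p) ∎
      where
      A : ℕ → Vec ℕ m → Vec ℕ m → ℤ → ℤ
      A p ps ms X = [ even p ] * ([ spineOK p ps ms ] * X)
      Π0 : ℕ → Vec ℕ m → Vec ℕ m → ℤ
      Π0 p ps ms = ΠF k (λ i → loopCount false (legAt p ps ms (toℕ i)))
      Π1 : ℕ → Vec ℕ m → Vec ℕ m → ℤ
      Π1 p ps ms = ΠF k (λ i → loopCount (toℕ i ℕ.≡ᵇ marked) (legAt p ps ms (toℕ i)))

    legWeight : ℕ → ℤ
    legWeight l = if l ℕ.≡ᵇ marked then 1ℤ else (if l ℕ.<ᵇ k then + suc τ else [ even τ ])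

    weighted-legFactor : ∀ l → ¬ (l ≡ marked) → weighted (legFactor l) ≡ (if l ℕ.<ᵇ k then + suc τ else [ even τ ])
    weighted-legFactor l ne with l ℕP.<? k
    ... | yes lt = trans (ΣN-ext B (λ y → cong (σ y *_) (legFactor-loop l y ne lt)))
                     (trans weighted-loopCount (sym (cong (λ b → if b then + suc τ else [ even τ ]) (<ᵇ-true l k lt))))
    ... | no nlt = trans (ΣN-ext B (λ y → cong (σ y *_) (legFactor-plain l y nlt)))
                     (trans weighted-one (sym (cong (λ b → if b then + suc τ else [ even τ ]) (<ᵇ-false l k nlt))))

    legWeight-unmarked : ∀ l → ¬ (l ≡ marked) → legWeight l ≡ (if l ℕ.<ᵇ k then + suc τ else [ even τ ])
    legWeight-unmarked l ne = cong (λ b → if b then 1ℤ else (if l ℕ.<ᵇ k then + suc τ else [ even τ ])) (≡ᵇ-false l marked ne)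

    legWeight-marked : legWeight marked ≡ 1ℤ
    legWeight-marked = cong (λ b → if b then 1ℤ else (if marked ℕ.<ᵇ k then + suc τ else [ even τ ])) (≡ᵇ-refl marked)

    weighted-legFactor≡legWeight : ∀ l → ¬ (l ≡ marked) → weighted (legFactor l) ≡ legWeight l
    weighted-legFactor≡legWeight l ne = trans (weighted-legFactor l ne) (sym (legWeight-unmarked l ne))

    -- The σ-weight the collapse needs comes from the marked loop: directly when it sits on leg 0,
    -- through spineSum-collapse-marked otherwise.
    spineSum≡legWeights : ΣN B (λ p → ([ even p ] * legFactor 0 p) * SC.spineSum legFactor m p) ≡ ΠN (suc (suc m)) legWeight
    spineSum≡legWeights with marked ℕP.≟ 0
    ... | yes eq0 = begin
        ΣN B (λ p → ([ even p ] * legFactor 0 p) * SC.spineSum legFactor m p)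
          ≡⟨ ΣN-ext B (λ p → cong (_* SC.spineSum legFactor m p)
               (trans (cong (λ l → [ even p ] * legFactor l p) (sym eq0)) (trans (cong ([ even p ] *_) (legFactor-marked p)) (loopCount-difference p)))) ⟩
        ΣN B (λ p → σ p * SC.spineSum legFactor m p)
          ≡⟨ SC.spineSum-collapse m legFactor ⟩
        ΠN (suc m) (λ j → weighted (legFactor (suc j)))
          ≡⟨ ΠN-ext (suc m) (λ j → weighted-legFactor≡legWeight (suc j) (λ e → ℕP.1+n≢0 (trans e eq0))) ⟩
        ΠN (suc m) (λ j → legWeight (suc j))
          ≡⟨ sym (trans (cong (_* ΠN (suc m) (λ j → legWeight (suc j))) (trans (cong legWeight (sym eq0)) legWeight-marked)) (ℤP.*-identityˡ _)) ⟩
        ΠN (suc (suc m)) legWeight ∎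
    ... | no ne0 = begin
        ΣN B (λ p → ([ even p ] * legFactor 0 p) * SC.spineSum legFactor m p)
          ≡⟨ ΣN-ext B (λ p → trans (regroup₁ [ even p ] (legFactor 0 p) (SC.spineSum legFactor m p)) (cong (legFactor 0 p *_) (SC.spineSum-collapse-marked m legFactor s s≤m marked-factor p))) ⟩
        ΣN B (λ p → legFactor 0 p * (σ p * Π-rest))
          ≡⟨ ΣN-ext B (λ p → regroup₂ (legFactor 0 p) (σ p) Π-rest) ⟩
        ΣN B (λ p → (σ p * legFactor 0 p) * Π-rest)
          ≡⟨ ΣN-*ʳ B Π-rest (λ p → σ p * legFactor 0 p) ⟩
        weighted (legFactor 0) * Π-rest
          ≡⟨ cong₂ _*_ (weighted-legFactor≡legWeight 0 (λ e → ne0 (sym e))) (ΠN-ext (suc m) rest-factor) ⟩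
        ΠN (suc (suc m)) legWeight ∎
      where
      s : ℕ
      s = ℕ.pred marked
      suc-s≡marked : suc s ≡ marked
      suc-s≡marked = ℕP.suc-pred marked {{ℕ.≢-nonZero ne0}}
      s≤m : s ≤ m
      s≤m = ℕP.≤-pred (subst (_≤ suc m) (sym suc-s≡marked) (ℕP.≤-pred (ℕP.≤-trans marked<k (ℕP.≤-trans (ℕP.m≤m+n k h) (ℕP.≤-reflexive k+h≡m+2)))))
      marked-factor : ∀ y → [ even y ] * legFactor (suc s) y ≡ σ y
      marked-factor y = trans (cong (λ l → [ even y ] * legFactor l y) suc-s≡marked) (trans (cong ([ even y ] *_) (legFactor-marked y)) (loopCount-difference y))
      Π-rest : ℤ
      Π-rest = ΠN (suc m) (λ j → if j ℕ.≡ᵇ s then 1ℤ else SC.weighted (legFactor (suc j)))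
      regroup₁ : ∀ a g l → (a * g) * l ≡ g * (a * l)
      regroup₁ = solve-∀
      regroup₂ : ∀ g a π → g * (a * π) ≡ (a * g) * π
      regroup₂ = solve-∀
      rest-factor : ∀ j → (if j ℕ.≡ᵇ s then 1ℤ else SC.weighted (legFactor (suc j))) ≡ legWeight (suc j)
      rest-factor j with j ℕP.≟ s
      ... | yes refl = trans (cong (λ b → if b then 1ℤ else SC.weighted (legFactor (suc j))) (≡ᵇ-refl j)) (sym (trans (cong legWeight suc-s≡marked) legWeight-marked))
      ... | no nej = trans (cong (λ b → if b then 1ℤ else SC.weighted (legFactor (suc j))) (≡ᵇ-false j s nej))
                       (weighted-legFactor≡legWeight (suc j) (λ e → nej (ℕP.suc-injective (trans e (sym suc-s≡marked)))))

    legWeights≡power : ΠN (suc (suc m)) legWeight ≡ + (suc τ ^ (k ℕ.∸ 1)) * ΠN h (λ _ → [ even τ ])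
    legWeights≡power = begin
      ΠN (suc (suc m)) legWeight
        ≡⟨ cong (λ n → ΠN n legWeight) (sym k+h≡m+2) ⟩
      ΠN (k ℕ.+ h) legWeight
        ≡⟨ ΠN-split k h legWeight ⟩
      ΠN k legWeight * ΠN h (λ x → legWeight (k ℕ.+ x))
        ≡⟨ cong₂ _*_ (trans (ΠN-cong k (λ l lt → cong (λ b → if l ℕ.≡ᵇ marked then 1ℤ else (if b then + suc τ else [ even τ ])) (<ᵇ-true l k lt)))
                            (ΠN-const-except k marked (suc τ) marked<k))
                     (ΠN-ext h (λ x → trans (legWeight-unmarked (k ℕ.+ x) (λ e → ℕP.<⇒≱ marked<k (subst (k ≤_) e (ℕP.m≤m+n k x))))
                                        (cong (λ b → if b then + suc τ else [ even τ ]) (<ᵇ-false (k ℕ.+ x) k (λ lt → ℕP.<⇒≱ lt (ℕP.m≤m+n k x)))))) ⟩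
      + (suc τ ^ (k ℕ.∸ 1)) * ΠN h (λ _ → [ even τ ]) ∎

    difference : + length Points₀.points - + length Points₁.points ≡ + (suc τ ^ (k ℕ.∸ 1)) * ΠN h (λ _ → [ even τ ])
    difference = trans (cong₂ _-_ length-points₀ length-points₁) (trans difference≡spineSum (trans spineSum≡legWeights legWeights≡power))

  difference-even : ∀ h k' τ {d : ℤ} → d ≡ + (suc τ ^ k') * ΠN h (λ _ → [ even τ ]) →
    (double τ ℕ.% 4 ≡ 0 ⊎ h ≡ 0) → d ≡ + ((double τ ℕ./ 2 ℕ.+ 1) ^ k')
  difference-even h k' τ d≡ c = begin
    _                                            ≡⟨ d≡ ⟩
    + (suc τ ^ k') * ΠN h (λ _ → [ even τ ])     ≡⟨ cong (+ (suc τ ^ k') *_) (evenFactors c) ⟩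
    + (suc τ ^ k') * 1ℤ                          ≡⟨ ℤP.*-identityʳ _ ⟩
    + (suc τ ^ k')                               ≡⟨ cong (λ n → + (n ^ k')) (sym (double/2+1≡suc τ)) ⟩
    + ((double τ ℕ./ 2 ℕ.+ 1) ^ k')              ∎
    where
    evenFactors : (double τ ℕ.% 4 ≡ 0 ⊎ h ≡ 0) → ΠN h (λ _ → [ even τ ]) ≡ 1ℤ
    evenFactors (inj₁ p) = ΠN-ones h _ (λ _ → cong [_] (double%4≡0⇒even τ p))
    evenFactors (inj₂ refl) = refl

  difference-odd : ∀ h k' τ {d : ℤ} → d ≡ + (suc τ ^ k') * ΠN h (λ _ → [ even τ ]) →
    (double τ ℕ.% 4 ≡ 2 × 1 ≤ h) → d ≡ + 0
  difference-odd h k' τ d≡ (p , 1≤h) =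
    trans d≡ (trans (cong (+ (suc τ ^ k') *_) (ΠN-zero-factor h _ 1≤h (cong [_] (double%4≡2⇒odd τ p)))) (ℤP.*-zeroʳ (+ (suc τ ^ k'))))

  difference-at-loop : ∀ h k' τ → 2 ≤ h ℕ.+ suc k' → (e : Fin (nE (G h (suc k')))) → IsLoop (G h (suc k')) e →
    Σ ℕ λ N₀ → Σ ℕ λ N₁ →
      VolIs (double τ) (G h (suc k')) ⊥ N₀ × VolIs (double τ) (G h (suc k')) ⁅ e ⁆ N₁ ×
      ((double τ ℕ.% 4 ≡ 0 ⊎ h ≡ 0) → + N₀ - + N₁ ≡ + ((double τ ℕ./ 2 ℕ.+ 1) ^ k')) ×
      ((double τ ℕ.% 4 ≡ 2 × 1 ≤ h) → + N₀ - + N₁ ≡ + 0)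
  difference-at-loop h k' τ hk e (v , occ) with Edges.loop⇒L (double τ) (h ℕ.+ suc k' ℕ.∸ 2) (suc k') e v occ
  ... | sp , e≡L =
    length Points₀.points , length Points₁.points , Points₀.points-volIs ,
    subst (λ e → VolIs (double τ) (G h (suc k')) ⁅ e ⁆ (length Points₁.points)) (sym e≡L) Points₁.points-volIs ,
    difference-even h k' τ difference , difference-odd h k' τ difference
    where open Setup h k' τ hk sp

open import Defs
open import Data.Nat using (ℕ; suc; z≤n; s≤s; _≤_; _/_; _%_; _^_; _∸_; _+_; _*_)
open import Data.Nat.Divisibility using (_∣_; divides)
open import Data.Integer using (+_; _-_)
open import Data.Fin using (Fin)
open import Data.Fin.Subset using (⁅_⁆; ⊥)
open import Data.Product using (Σ; _×_)
open import Data.Sum using (_⊎_)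
open import Relation.Binary.PropositionalEquality using (_≡_; refl; sym)
open Parity using (double≡*2)
open VolumeDifference using (difference-at-loop)

lemma9 : (h k : ℕ) → 1 ≤ k → 2 ≤ h + k →
    (e : Fin (nE (G h k))) → IsLoop (G h k) e → InternallyEulerian (G h k) ⁅ e ⁆ →
    (t : ℕ) → 2 ∣ t →
    Σ ℕ λ N₀ → Σ ℕ λ N₁ →
    VolIs t (G h k) ⊥ N₀ × VolIs t (G h k) ⁅ e ⁆ N₁ ×
    ((t % 4 ≡ 0 ⊎ h ≡ 0) → + N₀ - + N₁ ≡ + ((t / 2 + 1) ^ (k ∸ 1))) ×
    ((t % 4 ≡ 2 × 1 ≤ h) → + N₀ - + N₁ ≡ + 0)
lemma9 h (suc k') (s≤s z≤n) hk e isLoop _ .(τ * 2) (divides τ refl) rewrite sym (double≡*2 τ) =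
  difference-at-loop h k' τ hk e isLoop
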